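{- As formal power series in $x$ with coefficients in $\mathbb{Q}(t,q)$, \[ 1+\sum_{n\ge1}\frac{t\,\alpha_n(t,q)}{(1-t)^n}\,\frac{x^n}{2^{n-1}n!}=\frac{(1-t)-(q-t)\left(e^{x/2}-1\right)}{(1-t)-(q+t)\left(e^{x/2}-1\right)}. \]
   Context: A segmented permutation of size $n$ is a permutation $\sigma=\sigma_1\cdots\sigma_n$ of $\{1,\dots,n\}$, written as a word, together with a choice, for each position $i\in\{1,\dots,n-1\}$, of whether or not a bar is placed between $\sigma_i$ and $\sigma_{i+1}$. $SP_n$ is the set of these. A position $i<n$ is a segmentation if there is a bar between $\sigma_i$ and $\sigma_{i+1}$, and a descent if it is not a segmentation and $\sigma_i>\sigma_{i+1}$. $\operatorname{des}(\sigma)$, $\operatorname{seg}(\sigma)$ are the numbers of descents and segmentations. $\alpha_n(t,q)=\sum_{\sigma\in SP_n}t^{\operatorname{des}(\sigma)}q^{\operatorname{seg}(\sigma)}$. -}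

module Defs where

open import Data.Nat as ℕ using (ℕ; zero; suc; _<ᵇ_)
open import Data.Nat using (_!)
open import Data.Bool using (Bool; true; false; if_then_else_)
open import Data.List as List using (List; []; _∷_; _++_; concatMap; map; upTo)
open import Data.Vec as Vec using (Vec; []; _∷_)
open import Data.Rational as ℚ using (ℚ; 0ℚ; 1ℚ; _+_; _*_; _-_; -_; 1/_)
import Data.Integer as ℤ
open import Relation.Binary.PropositionalEquality using (_≢_)

insertions : ℕ → List ℕ → List (List ℕ)
insertions x []       = (x ∷ []) ∷ []
insertions x (y ∷ ys) = (x ∷ y ∷ ys) ∷ map (y ∷_) (insertions x ys)

permutationsOf : List ℕ → List (List ℕ)
permutationsOf []       = [] ∷ []
permutationsOf (x ∷ xs) = concatMap (insertions x) (permutationsOf xs)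

perms : ℕ → List (List ℕ)
perms n = permutationsOf (map suc (upTo n))

-- all bar choices: a Boolean for each position i ∈ {1,…,n-1}
-- (true = bar between σᵢ and σᵢ₊₁)
boolLists : ℕ → List (List Bool)
boolLists zero    = [] ∷ []
boolLists (suc k) = concatMap (λ bs → (true ∷ bs) ∷ (false ∷ bs) ∷ []) (boolLists k)

barChoices : ℕ → List (List Bool)
barChoices n = boolLists (n ℕ.∸ 1)

-- SP_n : each segmented permutation of size n as (word, bars), listed once
open import Data.Product using (_×_; _,_)


SP : ℕ → List (List ℕ × List Bool)
SP n = concatMap (λ σ → map (σ ,_) (barChoices n)) (perms n)

seg : List ℕ → List Bool → ℕ
seg (a ∷ b ∷ w) (true  ∷ bs) = suc (seg (b ∷ w) bs)
seg (a ∷ b ∷ w) (false ∷ bs) = seg (b ∷ w) bs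
seg _           _            = 0

des : List ℕ → List Bool → ℕ
des (a ∷ b ∷ w) (true  ∷ bs) = des (b ∷ w) bs
des (a ∷ b ∷ w) (false ∷ bs) = if b <ᵇ a then suc (des (b ∷ w) bs) else des (b ∷ w) bs
des _           _            = 0

infixr 8 _^_
_^_ : ℚ → ℕ → ℚ
x ^ zero  = 1ℚ
x ^ suc n = x * (x ^ n)

fromℕ : ℕ → ℚ
fromℕ n = ℚ.mkℚ+ n 1 (Data.Nat.Coprimality.sym (Data.Nat.Coprimality.1-coprimeTo n))
  where import Data.Nat.Coprimality

sumℚ : List ℚ → ℚ
sumℚ = List.foldr _+_ 0ℚ

-- α_n(t,q) = Σ_{σ ∈ SP_n} t^des(σ) q^seg(σ), evaluated at rationals t, q
α : ℕ → ℚ → ℚ → ℚ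
α n t q = sumℚ (map (λ { (σ , b) → (t ^ des σ b) * (q ^ seg σ b) }) (SP n))

Series : Set
Series = ℕ → ℚ

constS : ℚ → Series
constS c zero    = c
constS c (suc _) = 0ℚ

_⊖_ : Series → Series → Series
(f ⊖ g) n = f n - g n

_·_ : ℚ → Series → Series
(c · f) n = c * f n

-- 1/m for a positive natural m (the value at m = 0 is never used below)
recipℕ : ℕ → ℚ
recipℕ zero    = 0ℚ
recipℕ (suc k) = ℚ._/_ (ℤ.+ 1) (suc k)

expHalfMinus1 : Series
expHalfMinus1 zero    = 0ℚ
expHalfMinus1 (suc n) = recipℕ ((2 ℕ.^ suc n) ℕ.* ((suc n) !))

-- quotient f / g of power series, for g with invertible constant term g₀:
-- h₀ = f₀ / g₀,  h_{n+1} = (f_{n+1} - Σ_{k=1}^{n+1} g_k h_{n+1-k}) / g₀.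
-- divVec f g n = h_n ∷ h_{n-1} ∷ … ∷ h_0
module _ (f g : Series) (g₀≢0 : g 0 ≢ 0ℚ) where
  private
    g₀⁻¹ : ℚ
    g₀⁻¹ = (1/ g 0) ⦃ ℚ.≢-nonZero g₀≢0 ⦄

    conv : ∀ {m} → ℕ → Vec ℚ m → ℚ
    conv j []       = 0ℚ
    conv j (h ∷ hs) = g (suc j) * h + conv (suc j) hs

  divVec : (n : ℕ) → Vec ℚ (suc n)
  divVec zero    = (f 0 * g₀⁻¹) ∷ []
  divVec (suc n) = ((f (suc n) - conv 0 (divVec n)) * g₀⁻¹) ∷ divVec n

  divS : Series
  divS n = Vec.head (divVec n)

lhsSeries : (t q : ℚ) → 1ℚ - t ≢ 0ℚ → Series
lhsSeries t q _   zero    = 1ℚ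
lhsSeries t q t≢1 (suc m) =
  t * α (suc m) t q * ((1/ (1ℚ - t)) ⦃ ℚ.≢-nonZero t≢1 ⦄ ^ suc m)
    * recipℕ ((2 ℕ.^ m) ℕ.* ((suc m) !))

numSeries : ℚ → ℚ → Series
numSeries t q = constS (1ℚ - t) ⊖ ((q - t) · expHalfMinus1)

denSeries : ℚ → ℚ → Series
denSeries t q = constS (1ℚ - t) ⊖ ((q + t) · expHalfMinus1)

private
  open import Relation.Binary.PropositionalEquality using (_≡_; refl; trans; cong; sym)
  import Data.Rational.Properties as ℚP

  den₀ : ∀ t q → denSeries t q 0 ≡ 1ℚ - t
  den₀ t q = trans (cong (λ z → (1ℚ - t) - z) (ℚP.*-zeroʳ (q + t)))
                   (ℚP.+-identityʳ (1ℚ - t))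

den₀≢0 : ∀ t q → 1ℚ - t ≢ 0ℚ → denSeries t q 0 ≢ 0ℚ
den₀≢0 t q t≢1 e = t≢1 (trans (sym (den₀ t q)) e)

rhsSeries : (t q : ℚ) → 1ℚ - t ≢ 0ℚ → Series
rhsSeries t q t≢1 = divS (numSeries t q) (denSeries t q) (den₀≢0 t q t≢1)

{-# OPTIONS --safe #-}
-- Summing over the bars, the gap between σᵢ and σᵢ₊₁ contributes q + t if σᵢ > σᵢ₊₁ and q + 1
-- otherwise, so α_n(t,q) = Σ_{σ ∈ S_n} (q+t)^{des σ} (q+1)^{asc σ}, and inserting a new smallest
-- letter gives the Eulerian recurrence for such sums.  With ρ = 1/(1-t) and z = (q+t)ρ each term
-- of ρ^{n-1} α_n is z^{des σ} (1+z)^{asc σ}; expanding (1+z)^{asc σ} and using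
-- Σ_{σ ∈ S_n} C(asc σ, i) = Surj(n, n-i) gives ρ^{n-1} α_n = F_n(z) = Σ_k Surj(n, k+1) z^k, the
-- Fubini polynomial.  Splitting a surjection onto k+2 values by the preimage of the last one gives
-- F_n = 1 + z Σ_{m<n} C(n,m) F_m, i.e. y = Σ F_n x^n/(2^n n!) satisfies y = u + z u y with
-- u = e^{x/2} - 1.  The left side is 1 + 2tρ y, so its product with (1-t) - (q+t)u is
-- (1-t) - (q-t)u, and power-series quotients are unique.

module Submission where

open import Defs
open import Data.Bool using (Bool; true; false; if_then_else_; T)
open import Data.List using (List; []; _∷_; _++_; concatMap; map; length; upTo; applyUpTo)
import Data.List.Properties as ListP
open import Data.List.Relation.Unary.All as All using (All; []; _∷_)
import Data.List.Relation.Unary.All.Properties as AllP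
open import Data.List.Relation.Unary.AllPairs using (AllPairs; []; _∷_)
import Data.List.Relation.Unary.AllPairs.Properties as AllPairsP
open import Data.List.Relation.Binary.Permutation.Propositional using (_↭_; prep; swap; ↭-refl; ↭-sym; ↭-trans)
open import Data.List.Relation.Binary.Permutation.Propositional.Properties using (All-resp-↭; ↭-length)
open import Data.Nat as ℕ using (ℕ; zero; suc; _<ᵇ_; _<_; _≤_; z≤n; s≤s; _!)
import Data.Nat.Coprimality as Coprimality
import Data.Nat.Properties as ℕP
open import Data.Nat.Tactic.RingSolver using (solve-∀)
import Data.Integer as ℤ
import Data.Integer.Tactic.RingSolver as ℤSolver
open import Data.Product using (Σ-syntax; _×_; _,_; proj₁)
open import Data.Rational as ℚ using (ℚ; 0ℚ; 1ℚ; _+_; _*_; _-_; -_; 1/_; ≢-nonZero)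
import Data.Rational.Properties as ℚP
import Data.Rational.Unnormalised as ℚᵘ
import Data.Rational.Unnormalised.Properties as ℚᵘP
open import Data.Rational.Solver using (module +-*-Solver)
open +-*-Solver
open import Data.Sum using (inj₁; inj₂)
open import Data.Unit using (tt)
open import Data.Vec using (Vec; []; _∷_; head; tail)
open import Function using (_∘_; id)
open import Relation.Binary.PropositionalEquality
open ≡-Reasoning
open import Relation.Nullary using (contradiction)

ι : ℕ → ℚ
ι zero    = 0ℚ
ι (suc n) = 1ℚ + ι n

ι-homo-+ : ∀ m n → ι (m ℕ.+ n) ≡ ι m + ι n
ι-homo-+ zero    n = sym (ℚP.+-identityˡ (ι n))
ι-homo-+ (suc m) n = trans (cong (1ℚ +_) (ι-homo-+ m n)) (sym (ℚP.+-assoc 1ℚ (ι m) (ι n)))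

ι-homo-* : ∀ m n → ι (m ℕ.* n) ≡ ι m * ι n
ι-homo-* zero    n = sym (ℚP.*-zeroˡ (ι n))
ι-homo-* (suc m) n = begin
  ι (n ℕ.+ m ℕ.* n)  ≡⟨ ι-homo-+ n (m ℕ.* n) ⟩
  ι n + ι (m ℕ.* n)  ≡⟨ cong (ι n +_) (ι-homo-* m n) ⟩
  ι n + ι m * ι n    ≡⟨ solve 2 (λ a b → b :+ a :* b := (con 1ℚ :+ a) :* b) refl (ι m) (ι n) ⟩
  (1ℚ + ι m) * ι n   ∎

ι≡fromℕ : ∀ n → ι n ≡ fromℕ n
ι≡fromℕ zero    = refl
ι≡fromℕ (suc n) = trans (cong (1ℚ +_) (ι≡fromℕ n)) (ℚP.toℚᵘ-injective
  (ℚᵘP.≃-trans (ℚP.toℚᵘ-homo-+ 1ℚ (fromℕ n)) (ℚᵘ.*≡* (numerators (ℤ.+ n)))))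
  where
  numerators : ∀ x → (ℤ.+ 1 ℤ.* ℤ.+ 1 ℤ.+ x ℤ.* ℤ.+ 1) ℤ.* ℤ.+ 1 ≡ (ℤ.+ 1 ℤ.+ x) ℤ.* (ℤ.+ 1 ℤ.* ℤ.+ 1)
  numerators = ℤSolver.solve-∀

ι*recipℕ : ∀ k .{{_ : ℕ.NonZero k}} → ι k * recipℕ k ≡ 1ℚ
ι*recipℕ (suc k) = trans
  (cong₂ _*_ (ι≡fromℕ (suc k)) (ℚP.normalize-coprime (Coprimality.1-coprimeTo (suc k))))
  (ℚP.*-inverseʳ (fromℕ (suc k)))

recipℕ-unique : ∀ k .{{_ : ℕ.NonZero k}} {x} → ι k * x ≡ 1ℚ → x ≡ recipℕ k
recipℕ-unique k {x} kx≡1 = begin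
  x                     ≡⟨ sym (ℚP.*-identityˡ x) ⟩
  1ℚ * x                ≡⟨ cong (_* x) (sym (trans (ℚP.*-comm (recipℕ k) (ι k)) (ι*recipℕ k))) ⟩
  recipℕ k * ι k * x    ≡⟨ ℚP.*-assoc (recipℕ k) (ι k) x ⟩
  recipℕ k * (ι k * x)  ≡⟨ cong (recipℕ k *_) kx≡1 ⟩
  recipℕ k * 1ℚ         ≡⟨ ℚP.*-identityʳ (recipℕ k) ⟩
  recipℕ k              ∎

recipℕ-homo-* : ∀ m n .{{_ : ℕ.NonZero m}} .{{_ : ℕ.NonZero n}} →
  recipℕ (m ℕ.* n) ≡ recipℕ m * recipℕ n
recipℕ-homo-* m n = sym (recipℕ-unique (m ℕ.* n) {{ℕP.m*n≢0 m n}} (begin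
  ι (m ℕ.* n) * (recipℕ m * recipℕ n)  ≡⟨ cong (_* (recipℕ m * recipℕ n)) (ι-homo-* m n) ⟩
  ι m * ι n * (recipℕ m * recipℕ n)    ≡⟨ solve 4 (λ a b c d → a :* b :* (c :* d) := (a :* c) :* (b :* d))
                                                  refl (ι m) (ι n) (recipℕ m) (recipℕ n) ⟩
  ι m * recipℕ m * (ι n * recipℕ n)    ≡⟨ cong₂ _*_ (ι*recipℕ m) (ι*recipℕ n) ⟩
  1ℚ * 1ℚ                              ≡⟨ ℚP.*-identityˡ 1ℚ ⟩
  1ℚ                                   ∎))

^-distribˡ-+-* : ∀ x m n → x ^ (m ℕ.+ n) ≡ x ^ m * x ^ n
^-distribˡ-+-* x zero    n = sym (ℚP.*-identityˡ (x ^ n))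
^-distribˡ-+-* x (suc m) n = trans (cong (x *_) (^-distribˡ-+-* x m n)) (sym (ℚP.*-assoc x (x ^ m) (x ^ n)))

^-distribʳ-* : ∀ x y n → (x * y) ^ n ≡ x ^ n * y ^ n
^-distribʳ-* x y zero    = refl
^-distribʳ-* x y (suc n) = trans (cong ((x * y) *_) (^-distribʳ-* x y n))
  (solve 4 (λ x y a b → (x :* y) :* (a :* b) := (x :* a) :* (y :* b)) refl x y (x ^ n) (y ^ n))

-- Finite sums

sumℚ-++ : ∀ xs ys → sumℚ (xs ++ ys) ≡ sumℚ xs + sumℚ ys
sumℚ-++ []       ys = sym (ℚP.+-identityˡ (sumℚ ys))
sumℚ-++ (x ∷ xs) ys = trans (cong (x +_) (sumℚ-++ xs ys)) (sym (ℚP.+-assoc x (sumℚ xs) (sumℚ ys)))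

sumℚ-concatMap : ∀ {A B : Set} (f : B → ℚ) (g : A → List B) xs →
  sumℚ (map f (concatMap g xs)) ≡ sumℚ (map (λ x → sumℚ (map f (g x))) xs)
sumℚ-concatMap f g []       = refl
sumℚ-concatMap f g (x ∷ xs) = begin
  sumℚ (map f (g x ++ concatMap g xs))                ≡⟨ cong sumℚ (ListP.map-++ f (g x) (concatMap g xs)) ⟩
  sumℚ (map f (g x) ++ map f (concatMap g xs))        ≡⟨ sumℚ-++ (map f (g x)) (map f (concatMap g xs)) ⟩
  sumℚ (map f (g x)) + sumℚ (map f (concatMap g xs))  ≡⟨ cong (sumℚ (map f (g x)) +_) (sumℚ-concatMap f g xs) ⟩
  sumℚ (map f (g x)) + sumℚ (map (λ y → sumℚ (map f (g y))) xs) ∎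

*-distribˡ-sumℚ : ∀ {A : Set} c (f : A → ℚ) xs → c * sumℚ (map f xs) ≡ sumℚ (map (λ x → c * f x) xs)
*-distribˡ-sumℚ c f []       = ℚP.*-zeroʳ c
*-distribˡ-sumℚ c f (x ∷ xs) = trans (ℚP.*-distribˡ-+ c (f x) (sumℚ (map f xs)))
  (cong (c * f x +_) (*-distribˡ-sumℚ c f xs))

rangeSum : ℕ → (ℕ → ℚ) → ℚ
rangeSum zero    h = 0ℚ
rangeSum (suc n) h = h 0 + rangeSum n (h ∘ suc)

syntax rangeSum n (λ k → e) = ∑[ k < n ] e

rangeSum-cong : ∀ n {h h′} → (∀ k → k < n → h k ≡ h′ k) → rangeSum n h ≡ rangeSum n h′
rangeSum-cong zero    eq = refl
rangeSum-cong (suc n) eq = cong₂ _+_ (eq 0 (s≤s z≤n)) (rangeSum-cong n (λ k k<n → eq (suc k) (s≤s k<n)))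

rangeSum-last : ∀ n (h : ℕ → ℚ) → rangeSum (suc n) h ≡ rangeSum n h + h n
rangeSum-last zero    h = trans (ℚP.+-identityʳ (h 0)) (sym (ℚP.+-identityˡ (h 0)))
rangeSum-last (suc n) h = trans (cong (h 0 +_) (rangeSum-last n (h ∘ suc)))
  (sym (ℚP.+-assoc (h 0) (rangeSum n (h ∘ suc)) (h (suc n))))

rangeSum-distrib-+ : ∀ n (f g : ℕ → ℚ) → rangeSum n (λ k → f k + g k) ≡ rangeSum n f + rangeSum n g
rangeSum-distrib-+ zero    f g = refl
rangeSum-distrib-+ (suc n) f g = trans (cong (f 0 + g 0 +_) (rangeSum-distrib-+ n (f ∘ suc) (g ∘ suc)))
  (solve 4 (λ a b c d → (a :+ b) :+ (c :+ d) := (a :+ c) :+ (b :+ d)) refl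
     (f 0) (g 0) (rangeSum n (f ∘ suc)) (rangeSum n (g ∘ suc)))

*-distribˡ-rangeSum : ∀ n c (h : ℕ → ℚ) → c * rangeSum n h ≡ rangeSum n (λ k → c * h k)
*-distribˡ-rangeSum zero    c h = ℚP.*-zeroʳ c
*-distribˡ-rangeSum (suc n) c h = trans (ℚP.*-distribˡ-+ c (h 0) (rangeSum n (h ∘ suc)))
  (cong (c * h 0 +_) (*-distribˡ-rangeSum n c (h ∘ suc)))

rangeSum-zero : ∀ n → rangeSum n (λ _ → 0ℚ) ≡ 0ℚ
rangeSum-zero zero    = refl
rangeSum-zero (suc n) = trans (ℚP.+-identityˡ _) (rangeSum-zero n)

rangeSum-comm : ∀ m n (f : ℕ → ℕ → ℚ) → ∑[ i < m ] rangeSum n (f i) ≡ ∑[ j < n ] ∑[ i < m ] f i j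
rangeSum-comm zero    n f = sym (rangeSum-zero n)
rangeSum-comm (suc m) n f = begin
  rangeSum n (f 0) + ∑[ i < m ] rangeSum n (f (suc i))      ≡⟨ cong (rangeSum n (f 0) +_) (rangeSum-comm m n (f ∘ suc)) ⟩
  rangeSum n (f 0) + ∑[ j < n ] ∑[ i < m ] f (suc i) j      ≡⟨ sym (rangeSum-distrib-+ n (f 0) (λ j → ∑[ i < m ] f (suc i) j)) ⟩
  ∑[ j < n ] (f 0 j + ∑[ i < m ] f (suc i) j)               ∎

rangeSum-vanishing : ∀ {m n} (h : ℕ → ℚ) → m ≤ n → (∀ k → m ≤ k → h k ≡ 0ℚ) → rangeSum n h ≡ rangeSum m h
rangeSum-vanishing {n = zero}  h z≤n   vanish = refl
rangeSum-vanishing {m} {suc n} h m≤1+n vanish with ℕP.m≤n⇒m<n∨m≡n m≤1+n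
... | inj₂ refl  = refl
... | inj₁ m<1+n = begin
  rangeSum (suc n) h  ≡⟨ rangeSum-last n h ⟩
  rangeSum n h + h n  ≡⟨ cong₂ _+_ (rangeSum-vanishing h m≤n vanish) (vanish n m≤n) ⟩
  rangeSum m h + 0ℚ   ≡⟨ ℚP.+-identityʳ (rangeSum m h) ⟩
  rangeSum m h        ∎
  where m≤n = ℕP.≤-pred m<1+n

antidiagonalSum : ℕ → (ℕ → ℕ → ℚ) → ℚ
antidiagonalSum zero    φ = φ 0 0
antidiagonalSum (suc n) φ = φ 0 (suc n) + antidiagonalSum n (λ a b → φ (suc a) b)

syntax antidiagonalSum n (λ a b → e) = ∑[ a + b ≡ n ] e

antidiagonalSum-cong : ∀ n {φ ψ} → (∀ a b → a ℕ.+ b ≡ n → φ a b ≡ ψ a b) →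
  antidiagonalSum n φ ≡ antidiagonalSum n ψ
antidiagonalSum-cong zero    eq = eq 0 0 refl
antidiagonalSum-cong (suc n) eq =
  cong₂ _+_ (eq 0 (suc n) refl) (antidiagonalSum-cong n (λ a b a+b≡n → eq (suc a) b (cong suc a+b≡n)))

antidiagonalSum-zero : ∀ n (φ : ℕ → ℕ → ℚ) → (∀ a b → φ a b ≡ 0ℚ) → antidiagonalSum n φ ≡ 0ℚ
antidiagonalSum-zero zero    φ φ≡0 = φ≡0 0 0
antidiagonalSum-zero (suc n) φ φ≡0 =
  trans (cong₂ _+_ (φ≡0 0 (suc n)) (antidiagonalSum-zero n _ (λ a → φ≡0 (suc a)))) (ℚP.+-identityʳ 0ℚ)

antidiagonalSum-distrib-+ : ∀ n (φ ψ : ℕ → ℕ → ℚ) →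
  ∑[ a + b ≡ n ] (φ a b + ψ a b) ≡ antidiagonalSum n φ + antidiagonalSum n ψ
antidiagonalSum-distrib-+ zero    φ ψ = refl
antidiagonalSum-distrib-+ (suc n) φ ψ =
  trans (cong (φ 0 (suc n) + ψ 0 (suc n) +_) (antidiagonalSum-distrib-+ n _ _))
  (solve 4 (λ a b c d → (a :+ b) :+ (c :+ d) := (a :+ c) :+ (b :+ d)) refl (φ 0 (suc n)) (ψ 0 (suc n))
     (∑[ a + b ≡ n ] φ (suc a) b) (∑[ a + b ≡ n ] ψ (suc a) b))

*-distribˡ-antidiagonalSum : ∀ n c (φ : ℕ → ℕ → ℚ) → c * antidiagonalSum n φ ≡ ∑[ a + b ≡ n ] (c * φ a b)
*-distribˡ-antidiagonalSum zero    c φ = refl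
*-distribˡ-antidiagonalSum (suc n) c φ = trans (ℚP.*-distribˡ-+ c (φ 0 (suc n)) _)
  (cong (c * φ 0 (suc n) +_) (*-distribˡ-antidiagonalSum n c (λ a b → φ (suc a) b)))

antidiagonalSum-peelʳ : ∀ n (φ : ℕ → ℕ → ℚ) → antidiagonalSum (suc n) φ ≡ φ (suc n) 0 + ∑[ a + b ≡ n ] φ a (suc b)
antidiagonalSum-peelʳ zero    φ = ℚP.+-comm (φ 0 1) (φ 1 0)
antidiagonalSum-peelʳ (suc n) φ = trans (cong (φ 0 (suc (suc n)) +_) (antidiagonalSum-peelʳ n (λ a b → φ (suc a) b)))
  (solve 3 (λ a b c → a :+ (b :+ c) := b :+ (a :+ c)) refl
     (φ 0 (suc (suc n))) (φ (suc (suc n)) 0) (∑[ a + b ≡ n ] φ (suc a) (suc b)))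

antidiagonalSum-snd : ∀ n (h : ℕ → ℚ) → ∑[ a + b ≡ n ] h b ≡ rangeSum (suc n) h
antidiagonalSum-snd zero    h = sym (ℚP.+-identityʳ (h 0))
antidiagonalSum-snd (suc n) h =
  trans (antidiagonalSum-peelʳ n (λ _ b → h b)) (cong (h 0 +_) (antidiagonalSum-snd n (h ∘ suc)))

-- Binomial coefficients and surjections

choose : ℕ → ℕ → ℕ
choose n       zero    = 1
choose zero    (suc k) = 0
choose (suc n) (suc k) = choose n k ℕ.+ choose n (suc k)

choose-< : ∀ n k → n < k → choose n k ≡ 0
choose-< zero    (suc k) _         = refl
choose-< (suc n) (suc k) (s≤s n<k) = cong₂ ℕ._+_ (choose-< n k n<k) (choose-< n (suc k) (ℕP.m<n⇒m<1+n n<k))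

choose-diag : ∀ n → choose n n ≡ 1
choose-diag zero    = refl
choose-diag (suc n) = cong₂ ℕ._+_ (choose-diag n) (choose-< n (suc n) (ℕP.n<1+n n))

choose-1 : ∀ n → choose n 1 ≡ n
choose-1 zero    = refl
choose-1 (suc n) = cong suc (choose-1 n)

choose-absorption : ∀ a i → suc i ℕ.* choose a (suc i) ℕ.+ i ℕ.* choose a i ≡ a ℕ.* choose a i
choose-absorption zero    zero    = refl
choose-absorption zero    (suc i) = cong₂ ℕ._+_ (ℕP.*-zeroʳ (suc (suc i))) (ℕP.*-zeroʳ (suc i))
choose-absorption (suc a) zero    = trans (cong (λ c → 1 ℕ.* c ℕ.+ 0) (choose-1 (suc a))) (unit (suc a))
  where
  unit : ∀ n → 1 ℕ.* n ℕ.+ 0 ≡ n ℕ.* 1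
  unit = solve-∀
choose-absorption (suc a) (suc i) = begin
  (2 ℕ.+ i) ℕ.* (Q ℕ.+ W) ℕ.+ (1 ℕ.+ i) ℕ.* (P ℕ.+ Q)
    ≡⟨ regroup i P Q W ⟩
  ((2 ℕ.+ i) ℕ.* W ℕ.+ (1 ℕ.+ i) ℕ.* Q) ℕ.+ Q ℕ.+ (((1 ℕ.+ i) ℕ.* Q ℕ.+ i ℕ.* P) ℕ.+ P)
    ≡⟨ cong₂ (λ u v → u ℕ.+ Q ℕ.+ (v ℕ.+ P)) (choose-absorption a (suc i)) (choose-absorption a i) ⟩
  a ℕ.* Q ℕ.+ Q ℕ.+ (a ℕ.* P ℕ.+ P)
    ≡⟨ collect a P Q ⟩
  suc a ℕ.* (P ℕ.+ Q) ∎
  where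
  P = choose a i
  Q = choose a (suc i)
  W = choose a (suc (suc i))
  regroup : ∀ i P Q W → (2 ℕ.+ i) ℕ.* (Q ℕ.+ W) ℕ.+ (1 ℕ.+ i) ℕ.* (P ℕ.+ Q)
                      ≡ ((2 ℕ.+ i) ℕ.* W ℕ.+ (1 ℕ.+ i) ℕ.* Q) ℕ.+ Q ℕ.+ (((1 ℕ.+ i) ℕ.* Q ℕ.+ i ℕ.* P) ℕ.+ P)
  regroup = solve-∀
  collect : ∀ a P Q → a ℕ.* Q ℕ.+ Q ℕ.+ (a ℕ.* P ℕ.+ P) ≡ suc a ℕ.* (P ℕ.+ Q)
  collect = solve-∀

-- Adding a (C(a,i+1) + C(a,i)) to both sides turns this into choose-absorption.
insertMin-choose : ∀ i k d a → d ℕ.+ a ≡ i ℕ.+ k →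
  suc d ℕ.* choose (suc a) (suc i) ℕ.+ suc a ℕ.* choose a (suc i) ≡ suc k ℕ.* (choose a (suc i) ℕ.+ choose a i)
insertMin-choose i k d a d+a≡i+k = ℕP.+-cancelʳ-≡ (a ℕ.* (X ℕ.+ Y)) _ _ (begin
  suc d ℕ.* (Y ℕ.+ X) ℕ.+ suc a ℕ.* X ℕ.+ a ℕ.* (X ℕ.+ Y)  ≡⟨ step₁ d a X Y ⟩
  suc (d ℕ.+ a) ℕ.* (X ℕ.+ Y) ℕ.+ suc a ℕ.* X            ≡⟨ cong (λ m → suc m ℕ.* (X ℕ.+ Y) ℕ.+ suc a ℕ.* X) d+a≡i+k ⟩
  suc (i ℕ.+ k) ℕ.* (X ℕ.+ Y) ℕ.+ suc a ℕ.* X            ≡⟨ step₂ i k a X Y ⟩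
  suc k ℕ.* (X ℕ.+ Y) ℕ.+ a ℕ.* X ℕ.+ (suc i ℕ.* X ℕ.+ i ℕ.* Y)
    ≡⟨ cong (suc k ℕ.* (X ℕ.+ Y) ℕ.+ a ℕ.* X ℕ.+_) (choose-absorption a i) ⟩
  suc k ℕ.* (X ℕ.+ Y) ℕ.+ a ℕ.* X ℕ.+ a ℕ.* Y            ≡⟨ step₃ k a X Y ⟩
  suc k ℕ.* (X ℕ.+ Y) ℕ.+ a ℕ.* (X ℕ.+ Y)                ∎)
  where
  X = choose a (suc i)
  Y = choose a i
  step₁ : ∀ d a X Y → suc d ℕ.* (Y ℕ.+ X) ℕ.+ suc a ℕ.* X ℕ.+ a ℕ.* (X ℕ.+ Y)
                    ≡ suc (d ℕ.+ a) ℕ.* (X ℕ.+ Y) ℕ.+ suc a ℕ.* X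
  step₁ = solve-∀
  step₂ : ∀ i k a X Y → suc (i ℕ.+ k) ℕ.* (X ℕ.+ Y) ℕ.+ suc a ℕ.* X
                      ≡ suc k ℕ.* (X ℕ.+ Y) ℕ.+ a ℕ.* X ℕ.+ (suc i ℕ.* X ℕ.+ i ℕ.* Y)
  step₂ = solve-∀
  step₃ : ∀ k a X Y → suc k ℕ.* (X ℕ.+ Y) ℕ.+ a ℕ.* X ℕ.+ a ℕ.* Y ≡ suc k ℕ.* (X ℕ.+ Y) ℕ.+ a ℕ.* (X ℕ.+ Y)
  step₃ = solve-∀

choose-factorials : ∀ a b → choose (a ℕ.+ b) b ℕ.* (a ! ℕ.* b !) ≡ (a ℕ.+ b) !
choose-factorials a       zero    = trans (ℕP.+-identityʳ _) (trans (ℕP.*-identityʳ (a !)) (cong _! (sym (ℕP.+-identityʳ a))))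
choose-factorials zero    (suc b) = trans (cong (ℕ._* (1 ℕ.* suc b !)) (choose-diag (suc b))) (trans (ℕP.*-identityˡ _) (ℕP.*-identityˡ _))
choose-factorials (suc a) (suc b) = begin
  (choose K b ℕ.+ choose K (suc b)) ℕ.* (suc a ! ℕ.* suc b !)
    ≡⟨ split (choose K b) (choose K (suc b)) (a !) (b !) a b ⟩
  choose K b ℕ.* (suc a ! ℕ.* b !) ℕ.* suc b ℕ.+ choose K (suc b) ℕ.* (a ! ℕ.* suc b !) ℕ.* suc a
    ≡⟨ cong₂ (λ u v → u ℕ.* suc b ℕ.+ v ℕ.* suc a) shifted (choose-factorials a (suc b)) ⟩
  K ! ℕ.* suc b ℕ.+ K ! ℕ.* suc a
    ≡⟨ merge a b (K !) ⟩
  suc (a ℕ.+ suc b) ℕ.* K ! ∎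
  where
  K = a ℕ.+ suc b
  shifted : choose K b ℕ.* (suc a ! ℕ.* b !) ≡ K !
  shifted = subst (λ m → choose m b ℕ.* (suc a ! ℕ.* b !) ≡ m !) (sym (ℕP.+-suc a b)) (choose-factorials (suc a) b)
  split : ∀ P Q x y a b → (P ℕ.+ Q) ℕ.* ((suc a ℕ.* x) ℕ.* (suc b ℕ.* y))
                        ≡ P ℕ.* ((suc a ℕ.* x) ℕ.* y) ℕ.* suc b ℕ.+ Q ℕ.* (x ℕ.* (suc b ℕ.* y)) ℕ.* suc a
  split = solve-∀
  merge : ∀ a b k → k ℕ.* suc b ℕ.+ k ℕ.* suc a ≡ suc (a ℕ.+ suc b) ℕ.* k
  merge = solve-∀

surjections : ℕ → ℕ → ℕ
surjections zero    zero    = 1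
surjections zero    (suc K) = 0
surjections (suc n) zero    = 0
surjections (suc n) (suc K) = suc K ℕ.* (surjections n (suc K) ℕ.+ surjections n K)

surjections-< : ∀ n K → n < K → surjections n K ≡ 0
surjections-< zero    (suc K) _         = refl
surjections-< (suc n) (suc K) (s≤s n<K) = trans
  (cong (suc K ℕ.*_) (cong₂ ℕ._+_ (surjections-< n (suc K) (ℕP.m<n⇒m<1+n n<K)) (surjections-< n K n<K)))
  (ℕP.*-zeroʳ (suc K))

surjections-onto-1 : ∀ n → surjections (suc n) 1 ≡ 1
surjections-onto-1 zero    = refl
surjections-onto-1 (suc n) = cong (λ m → 1 ℕ.* (m ℕ.+ 0)) (surjections-onto-1 n)

ι-surjections : ∀ n K → ι (surjections (suc n) (suc K)) ≡ ι (suc K) * (ι (surjections n (suc K)) + ι (surjections n K))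
ι-surjections n K = trans (ι-homo-* (suc K) (surjections n (suc K) ℕ.+ surjections n K))
  (cong (ι (suc K) *_) (ι-homo-+ (surjections n (suc K)) (surjections n K)))

rangeSum-pascal : ∀ n (h : ℕ → ℚ) → ∑[ m < suc n ] (ι (choose (suc n) m) * h m)
                        ≡ ∑[ m < suc n ] (ι (choose n m) * h m) + ∑[ m < n ] (ι (choose n m) * h (suc m))
rangeSum-pascal n h = begin
  ι 1 * h 0 + ∑[ m < n ] (ι (choose n m ℕ.+ choose n (suc m)) * h (suc m))
    ≡⟨ cong (ι 1 * h 0 +_) (trans (rangeSum-cong n (λ m _ → split m)) (rangeSum-distrib-+ n _ _)) ⟩
  ι 1 * h 0 + (∑[ m < n ] (ι (choose n m) * h (suc m)) + ∑[ m < n ] (ι (choose n (suc m)) * h (suc m)))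
    ≡⟨ solve 3 (λ a b c → a :+ (b :+ c) := (a :+ c) :+ b) refl (ι 1 * h 0)
         (∑[ m < n ] (ι (choose n m) * h (suc m))) (∑[ m < n ] (ι (choose n (suc m)) * h (suc m))) ⟩
  ι 1 * h 0 + ∑[ m < n ] (ι (choose n (suc m)) * h (suc m)) + ∑[ m < n ] (ι (choose n m) * h (suc m)) ∎
  where
  split : ∀ m → ι (choose n m ℕ.+ choose n (suc m)) * h (suc m) ≡ ι (choose n m) * h (suc m) + ι (choose n (suc m)) * h (suc m)
  split m = trans (cong (_* h (suc m)) (ι-homo-+ (choose n m) (choose n (suc m))))
    (ℚP.*-distribʳ-+ (h (suc m)) (ι (choose n m)) (ι (choose n (suc m))))

rangeSum-choose*surjections-suc : ∀ n K →
  ∑[ m < n ] (ι (choose n m) * ι (surjections (suc m) (suc K)))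
  ≡ ι (suc K) * (∑[ m < n ] (ι (choose n m) * ι (surjections m (suc K))) + ∑[ m < n ] (ι (choose n m) * ι (surjections m K)))
rangeSum-choose*surjections-suc n K = begin
  ∑[ m < n ] (ι (choose n m) * ι (surjections (suc m) (suc K)))
    ≡⟨ rangeSum-cong n (λ m _ → trans (cong (ι (choose n m) *_) (ι-surjections m K)) (distribute m)) ⟩
  ∑[ m < n ] (ι (suc K) * (A m + B m))
    ≡⟨ sym (*-distribˡ-rangeSum n (ι (suc K)) (λ m → A m + B m)) ⟩
  ι (suc K) * ∑[ m < n ] (A m + B m)
    ≡⟨ cong (ι (suc K) *_) (rangeSum-distrib-+ n A B) ⟩
  ι (suc K) * (rangeSum n A + rangeSum n B) ∎
  where
  A B : ℕ → ℚ
  A m = ι (choose n m) * ι (surjections m (suc K))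
  B m = ι (choose n m) * ι (surjections m K)
  distribute : ∀ m → ι (choose n m) * (ι (suc K) * (ι (surjections m (suc K)) + ι (surjections m K))) ≡ ι (suc K) * (A m + B m)
  distribute m = solve 4 (λ c k y u → c :* (k :* (y :+ u)) := k :* (c :* y :+ c :* u)) refl
    (ι (choose n m)) (ι (suc K)) (ι (surjections m (suc K))) (ι (surjections m K))

surjections-convolution : ∀ n K → ι (surjections n (suc K)) ≡ ∑[ m < n ] (ι (choose n m) * ι (surjections m K))
surjections-convolution zero    K = refl
surjections-convolution (suc n) K = sym (begin
  ∑[ m < suc n ] (ι (choose (suc n) m) * ι (surjections m K))
    ≡⟨ rangeSum-pascal n (λ m → ι (surjections m K)) ⟩
  ∑[ m < suc n ] (ι (choose n m) * ι (surjections m K)) + ∑[ m < n ] (ι (choose n m) * ι (surjections (suc m) K))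
    ≡⟨ cong₂ _+_ lower (upper K) ⟩
  ι (surjections n (suc K)) + ι 1 * ι (surjections n K) + ι K * (ι (surjections n (suc K)) + ι (surjections n K))
    ≡⟨ solve 3 (λ x y c → x :+ (con 1ℚ :+ con 0ℚ) :* y :+ c :* (x :+ y) := (con 1ℚ :+ c) :* (x :+ y)) refl
         (ι (surjections n (suc K))) (ι (surjections n K)) (ι K) ⟩
  ι (suc K) * (ι (surjections n (suc K)) + ι (surjections n K))
    ≡⟨ sym (ι-surjections n K) ⟩
  ι (surjections (suc n) (suc K)) ∎)
  where
  lower : ∑[ m < suc n ] (ι (choose n m) * ι (surjections m K)) ≡ ι (surjections n (suc K)) + ι 1 * ι (surjections n K)
  lower = trans (rangeSum-last n (λ m → ι (choose n m) * ι (surjections m K)))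
    (cong₂ _+_ (sym (surjections-convolution n K)) (cong (λ c → ι c * ι (surjections n K)) (choose-diag n)))
  upper : ∀ K → ∑[ m < n ] (ι (choose n m) * ι (surjections (suc m) K)) ≡ ι K * (ι (surjections n (suc K)) + ι (surjections n K))
  upper zero    = trans (rangeSum-cong n (λ m _ → ℚP.*-zeroʳ (ι (choose n m))))
    (trans (rangeSum-zero n) (sym (ℚP.*-zeroˡ (ι (surjections n 1) + ι (surjections n 0)))))
  upper (suc K) = trans (rangeSum-choose*surjections-suc n K)
    (cong (ι (suc K) *_) (sym (cong₂ _+_ (surjections-convolution n (suc K)) (surjections-convolution n K))))

-- Eulerian sums

descents : List ℕ → ℕ
descents (a ∷ b ∷ w) = if b <ᵇ a then suc (descents (b ∷ w)) else descents (b ∷ w)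
descents _           = 0

ascents : List ℕ → ℕ
ascents (a ∷ b ∷ w) = if b <ᵇ a then ascents (b ∷ w) else suc (ascents (b ∷ w))
ascents _           = 0

Table : Set
Table = ℕ → ℕ → ℚ

weight : Table → List ℕ → ℚ
weight G σ = G (descents σ) (ascents σ)

insertMin : Table → Table
insertMin G d a = ι (suc d) * G d (suc a) + ι (suc a) * G (suc d) a

-- eulerianSum n G sums G (des σ) (asc σ) over the permutations σ of size n + 1.  Inserting a new
-- smallest letter into a word with d descents and a ascents yields d + 1 words with a + 1 ascents
-- (front and descent slots) and a + 1 words with d + 1 descents (ascent slots and the end).
eulerianSum : ℕ → Table → ℚ
eulerianSum zero    G = G 0 0
eulerianSum (suc n) G = eulerianSum n (insertMin G)

eulerianSum-cong : ∀ n {G H} → (∀ d a → d ℕ.+ a ≡ n → G d a ≡ H d a) → eulerianSum n G ≡ eulerianSum n H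
eulerianSum-cong zero    eq = eq 0 0 refl
eulerianSum-cong (suc n) eq = eulerianSum-cong n (λ d a d+a≡n → cong₂ _+_
  (cong (ι (suc d) *_) (eq d (suc a) (trans (ℕP.+-suc d a) (cong suc d+a≡n))))
  (cong (ι (suc a) *_) (eq (suc d) a (cong suc d+a≡n))))

eulerianSum-distrib-+ : ∀ n (G H : Table) → eulerianSum n (λ d a → G d a + H d a) ≡ eulerianSum n G + eulerianSum n H
eulerianSum-distrib-+ zero    G H = refl
eulerianSum-distrib-+ (suc n) G H = trans (eulerianSum-cong n (λ d a _ → regroup (ι (suc d)) (ι (suc a))
    (G d (suc a)) (H d (suc a)) (G (suc d) a) (H (suc d) a)))
  (eulerianSum-distrib-+ n (insertMin G) (insertMin H))
  where
  regroup : ∀ x y g₁ h₁ g₂ h₂ → x * (g₁ + h₁) + y * (g₂ + h₂) ≡ (x * g₁ + y * g₂) + (x * h₁ + y * h₂)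
  regroup = solve 6 (λ x y g₁ h₁ g₂ h₂ → x :* (g₁ :+ h₁) :+ y :* (g₂ :+ h₂)
                                       := (x :* g₁ :+ y :* g₂) :+ (x :* h₁ :+ y :* h₂)) refl

*-distribˡ-eulerianSum : ∀ n c (G : Table) → c * eulerianSum n G ≡ eulerianSum n (λ d a → c * G d a)
*-distribˡ-eulerianSum zero    c G = refl
*-distribˡ-eulerianSum (suc n) c G = trans (*-distribˡ-eulerianSum n c (insertMin G))
  (eulerianSum-cong n (λ d a _ → commute c (ι (suc d)) (ι (suc a)) (G d (suc a)) (G (suc d) a)))
  where
  commute : ∀ c x y g₁ g₂ → c * (x * g₁ + y * g₂) ≡ x * (c * g₁) + y * (c * g₂)
  commute = solve 5 (λ c x y g₁ g₂ → c :* (x :* g₁ :+ y :* g₂) := x :* (c :* g₁) :+ y :* (c :* g₂)) refl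

*-distribʳ-eulerianSum : ∀ n c (G : Table) → eulerianSum n (λ d a → G d a * c) ≡ eulerianSum n G * c
*-distribʳ-eulerianSum n c G = begin
  eulerianSum n (λ d a → G d a * c)  ≡⟨ eulerianSum-cong n (λ d a _ → ℚP.*-comm (G d a) c) ⟩
  eulerianSum n (λ d a → c * G d a)  ≡⟨ sym (*-distribˡ-eulerianSum n c G) ⟩
  c * eulerianSum n G                ≡⟨ ℚP.*-comm c (eulerianSum n G) ⟩
  eulerianSum n G * c                ∎

eulerianSum-zero : ∀ n → eulerianSum n (λ _ _ → 0ℚ) ≡ 0ℚ
eulerianSum-zero n = trans (sym (*-distribˡ-eulerianSum n 0ℚ (λ _ _ → 0ℚ))) (ℚP.*-zeroˡ (eulerianSum n (λ _ _ → 0ℚ)))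

eulerianSum-antidiagonalSum : ∀ n N (Φ : ℕ → ℕ → ℕ → ℕ → ℚ) →
  eulerianSum n (λ d a → antidiagonalSum N (Φ d a)) ≡ ∑[ i + k ≡ N ] eulerianSum n (λ d a → Φ d a i k)
eulerianSum-antidiagonalSum n zero    Φ = refl
eulerianSum-antidiagonalSum n (suc N) Φ =
  trans (eulerianSum-distrib-+ n (λ d a → Φ d a 0 (suc N)) (λ d a → ∑[ i + k ≡ N ] Φ d a (suc i) k))
  (cong (eulerianSum n (λ d a → Φ d a 0 (suc N)) +_) (eulerianSum-antidiagonalSum n N (λ d a i → Φ d a (suc i))))

<ᵇ-true : ∀ {m n} → m < n → (m <ᵇ n) ≡ true
<ᵇ-true {m} {n} m<n with m <ᵇ n | ℕP.<⇒<ᵇ m<n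
... | true | _ = refl

<ᵇ-false : ∀ {m n} → m < n → (n <ᵇ m) ≡ false
<ᵇ-false {m} {n} m<n with n <ᵇ m in eq
... | false = refl
... | true  = contradiction (ℕP.<ᵇ⇒< n m (subst T (sym eq) tt)) (ℕP.<-asym m<n)

stepShift : Bool → Table → Table
stepShift true  G d a = G (suc d) a
stepShift false G d a = G d (suc a)

weight-∷∷ : ∀ G y z v → weight G (y ∷ z ∷ v) ≡ weight (stepShift (z <ᵇ y) G) (z ∷ v)
weight-∷∷ G y z v with z <ᵇ y
... | true  = refl
... | false = refl

weight-min-∷ : ∀ G {x y} u → x < y → weight G (x ∷ y ∷ u) ≡ G (descents (y ∷ u)) (suc (ascents (y ∷ u)))
weight-min-∷ G {x} {y} u x<y = trans (weight-∷∷ G x y u) (cong (λ b → weight (stepShift b G) (y ∷ u)) (<ᵇ-false x<y))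

weight-after-min : ∀ G {x y} v → x < y → weight G (y ∷ x ∷ v) ≡ weight (stepShift true G) (x ∷ v)
weight-after-min G {x} {y} v x<y = trans (weight-∷∷ G y x v) (cong (λ b → weight (stepShift b G) (x ∷ v)) (<ᵇ-true x<y))

-- The part of insertMin coming from the slots after the first letter.
insertMinInTail : Table → Table
insertMinInTail G d a = ι d * G d (suc a) + ι (suc a) * G (suc d) a

insertMinInTail-stepShift : ∀ b G d a →
  G (suc d) (suc a) + insertMinInTail (stepShift b G) d a ≡ insertMinInTail G (if b then suc d else d) (if b then a else suc a)
insertMinInTail-stepShift true  G d a =
  solve 4 (λ X Y c e → X :+ (c :* X :+ e :* Y) := (con 1ℚ :+ c) :* X :+ e :* Y) refl
    (G (suc d) (suc a)) (G (suc (suc d)) a) (ι d) (ι (suc a))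
insertMinInTail-stepShift false G d a =
  solve 4 (λ X Y c e → X :+ (c :* Y :+ e :* X) := c :* Y :+ (con 1ℚ :+ e) :* X) refl
    (G (suc d) (suc a)) (G d (suc (suc a))) (ι d) (ι (suc a))

sum-insertions-tail : ∀ {x} y w G → x < y → All (x <_) w →
  sumℚ (map (weight G ∘ (y ∷_)) (insertions x w)) ≡ insertMinInTail G (descents (y ∷ w)) (ascents (y ∷ w))
sum-insertions-tail {x} y [] G x<y [] = begin
  weight G (y ∷ x ∷ []) + 0ℚ  ≡⟨ cong (_+ 0ℚ) (weight-after-min G [] x<y) ⟩
  G 1 0 + 0ℚ                  ≡⟨ solve 2 (λ X Y → Y :+ con 0ℚ := con 0ℚ :* X :+ (con 1ℚ :+ con 0ℚ) :* Y) refl (G 0 1) (G 1 0) ⟩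
  insertMinInTail G 0 0       ∎
sum-insertions-tail {x} y (z ∷ w) G x<y (x<z ∷ x<w) = begin
  weight G (y ∷ x ∷ z ∷ w) + sumℚ (map (weight G ∘ (y ∷_)) (map (z ∷_) (insertions x w)))
    ≡⟨ cong₂ _+_ (trans (weight-after-min G (z ∷ w) x<y) (weight-min-∷ (stepShift true G) w x<z)) rest ⟩
  G (suc d) (suc a) + insertMinInTail (stepShift (z <ᵇ y) G) d a
    ≡⟨ insertMinInTail-stepShift (z <ᵇ y) G d a ⟩
  insertMinInTail G (descents (y ∷ z ∷ w)) (ascents (y ∷ z ∷ w)) ∎
  where
  d = descents (z ∷ w)
  a = ascents (z ∷ w)
  rest : sumℚ (map (weight G ∘ (y ∷_)) (map (z ∷_) (insertions x w))) ≡ insertMinInTail (stepShift (z <ᵇ y) G) d a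
  rest = begin
    sumℚ (map (weight G ∘ (y ∷_)) (map (z ∷_) (insertions x w)))
      ≡⟨ cong sumℚ (sym (ListP.map-∘ (insertions x w))) ⟩
    sumℚ (map (λ v → weight G (y ∷ z ∷ v)) (insertions x w))
      ≡⟨ cong sumℚ (ListP.map-cong (weight-∷∷ G y z) (insertions x w)) ⟩
    sumℚ (map (weight (stepShift (z <ᵇ y) G) ∘ (z ∷_)) (insertions x w))
      ≡⟨ sum-insertions-tail z w (stepShift (z <ᵇ y) G) x<z x<w ⟩
    insertMinInTail (stepShift (z <ᵇ y) G) d a ∎

sum-insertions : ∀ {x} y u G → All (x <_) (y ∷ u) →
  sumℚ (map (weight G) (insertions x (y ∷ u))) ≡ weight (insertMin G) (y ∷ u)
sum-insertions {x} y u G (x<y ∷ x<u) = begin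
  weight G (x ∷ y ∷ u) + sumℚ (map (weight G) (map (y ∷_) (insertions x u)))
    ≡⟨ cong₂ _+_ (weight-min-∷ G u x<y)
         (trans (cong sumℚ (sym (ListP.map-∘ (insertions x u)))) (sum-insertions-tail y u G x<y x<u)) ⟩
  G d (suc a) + insertMinInTail G d a
    ≡⟨ solve 4 (λ X Y c e → X :+ (c :* X :+ e :* Y) := (con 1ℚ :+ c) :* X :+ e :* Y) refl
         (G d (suc a)) (G (suc d) a) (ι d) (ι (suc a)) ⟩
  insertMin G d a ∎
  where
  d = descents (y ∷ u)
  a = ascents (y ∷ u)

insertions-↭ : ∀ x w → All (_↭ x ∷ w) (insertions x w)
insertions-↭ x []       = ↭-refl ∷ []
insertions-↭ x (y ∷ ys) = ↭-refl ∷ AllP.map⁺ (All.map (λ v↭ → ↭-trans (prep y v↭) (swap y x ↭-refl)) (insertions-↭ x ys))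

permutationsOf-↭ : ∀ xs → All (_↭ xs) (permutationsOf xs)
permutationsOf-↭ []       = ↭-refl ∷ []
permutationsOf-↭ (x ∷ xs) = AllP.concat⁺ (AllP.map⁺ (All.map
  (λ {τ} τ↭xs → All.map (λ σ↭ → ↭-trans σ↭ (prep x τ↭xs)) (insertions-↭ x τ))
  (permutationsOf-↭ xs)))

map-suc-upTo-sorted : ∀ n → AllPairs _<_ (map suc (upTo n))
map-suc-upTo-sorted n = AllPairsP.map⁺ (AllPairsP.applyUpTo⁺₁ id n (λ i<j _ → s≤s i<j))

sum-permutationsOf : ∀ x xs G → AllPairs _<_ (x ∷ xs) →
  sumℚ (map (weight G) (permutationsOf (x ∷ xs))) ≡ eulerianSum (length xs) G
sum-permutationsOf x []       G _ = ℚP.+-identityʳ (G 0 0)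
sum-permutationsOf x (y ∷ ys) G (x<y∷ys ∷ sorted) = begin
  sumℚ (map (weight G) (concatMap (insertions x) (permutationsOf (y ∷ ys))))
    ≡⟨ sumℚ-concatMap (weight G) (insertions x) (permutationsOf (y ∷ ys)) ⟩
  sumℚ (map (λ σ → sumℚ (map (weight G) (insertions x σ))) (permutationsOf (y ∷ ys)))
    ≡⟨ cong sumℚ (ListP.map-cong-local (All.map sum-insertions-↭ (permutationsOf-↭ (y ∷ ys)))) ⟩
  sumℚ (map (weight (insertMin G)) (permutationsOf (y ∷ ys)))
    ≡⟨ sum-permutationsOf y ys (insertMin G) sorted ⟩
  eulerianSum (length ys) (insertMin G) ∎
  where
  sum-insertions-↭ : ∀ {σ} → σ ↭ y ∷ ys → sumℚ (map (weight G) (insertions x σ)) ≡ weight (insertMin G) σ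
  sum-insertions-↭ {[]}     σ↭ = contradiction (↭-length σ↭) λ ()
  sum-insertions-↭ {z ∷ zs} σ↭ = sum-insertions z zs G (All-resp-↭ (↭-sym σ↭) x<y∷ys)

module _ (t q : ℚ) where

  barWeight : List ℕ → List Bool → ℚ
  barWeight σ bs = t ^ des σ bs * q ^ seg σ bs

  ascDesWeight : Table
  ascDesWeight d a = (q + t) ^ d * (q + 1ℚ) ^ a

  stepWeight : ℕ → ℕ → ℚ
  stepWeight a b = if b <ᵇ a then q + t else q + 1ℚ

  barWeight-choices : ∀ x y w bs →
    barWeight (x ∷ y ∷ w) (true ∷ bs) + (barWeight (x ∷ y ∷ w) (false ∷ bs) + 0ℚ) ≡ stepWeight x y * barWeight (y ∷ w) bs
  barWeight-choices x y w bs with y <ᵇ x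
  ... | true  = solve 4 (λ t q a b → a :* (q :* b) :+ ((t :* a) :* b :+ con 0ℚ) := (q :+ t) :* (a :* b)) refl
                  t q (t ^ des (y ∷ w) bs) (q ^ seg (y ∷ w) bs)
  ... | false = solve 3 (λ q a b → a :* (q :* b) :+ (a :* b :+ con 0ℚ) := (q :+ con 1ℚ) :* (a :* b)) refl
                  q (t ^ des (y ∷ w) bs) (q ^ seg (y ∷ w) bs)

  stepWeight-weight : ∀ x y w → stepWeight x y * weight ascDesWeight (y ∷ w) ≡ weight ascDesWeight (x ∷ y ∷ w)
  stepWeight-weight x y w with y <ᵇ x
  ... | true  = sym (ℚP.*-assoc (q + t) _ _)
  ... | false = solve 3 (λ p a b → p :* (a :* b) := a :* (p :* b)) refl (q + 1ℚ) ((q + t) ^ descents (y ∷ w)) ((q + 1ℚ) ^ ascents (y ∷ w))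

  sum-bars : ∀ x w → sumℚ (map (barWeight (x ∷ w)) (boolLists (length w))) ≡ weight ascDesWeight (x ∷ w)
  sum-bars x []      = ℚP.+-identityʳ _
  sum-bars x (y ∷ w) = begin
    sumℚ (map (barWeight (x ∷ y ∷ w)) (concatMap (λ bs → (true ∷ bs) ∷ (false ∷ bs) ∷ []) (boolLists (length w))))
      ≡⟨ sumℚ-concatMap (barWeight (x ∷ y ∷ w)) _ (boolLists (length w)) ⟩
    sumℚ (map (λ bs → barWeight (x ∷ y ∷ w) (true ∷ bs) + (barWeight (x ∷ y ∷ w) (false ∷ bs) + 0ℚ)) (boolLists (length w)))
      ≡⟨ cong sumℚ (ListP.map-cong (barWeight-choices x y w) (boolLists (length w))) ⟩
    sumℚ (map (λ bs → stepWeight x y * barWeight (y ∷ w) bs) (boolLists (length w)))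
      ≡⟨ sym (*-distribˡ-sumℚ (stepWeight x y) (barWeight (y ∷ w)) (boolLists (length w))) ⟩
    stepWeight x y * sumℚ (map (barWeight (y ∷ w)) (boolLists (length w)))
      ≡⟨ cong (stepWeight x y *_) (sum-bars y w) ⟩
    stepWeight x y * weight ascDesWeight (y ∷ w)
      ≡⟨ stepWeight-weight x y w ⟩
    weight ascDesWeight (x ∷ y ∷ w) ∎

  α-eulerian : ∀ N → α (suc N) t q ≡ eulerianSum N ascDesWeight
  α-eulerian N = begin
    sumℚ (map pairWeight (concatMap (λ σ → map (σ ,_) (boolLists N)) (perms (suc N))))
      ≡⟨ sumℚ-concatMap pairWeight (λ σ → map (σ ,_) (boolLists N)) (perms (suc N)) ⟩
    sumℚ (map (λ σ → sumℚ (map pairWeight (map (σ ,_) (boolLists N)))) (perms (suc N)))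
      ≡⟨ cong sumℚ (ListP.map-cong (λ σ → cong sumℚ (sym (ListP.map-∘ (boolLists N)))) (perms (suc N))) ⟩
    sumℚ (map (λ σ → sumℚ (map (barWeight σ) (boolLists N))) (perms (suc N)))
      ≡⟨ cong sumℚ (ListP.map-cong-local (All.map (λ {σ} σ↭ → sum-bars-of-length {σ} (trans (↭-length σ↭) (cong suc length-rest)))
                                                 (permutationsOf-↭ (1 ∷ rest)))) ⟩
    sumℚ (map (weight ascDesWeight) (perms (suc N)))
      ≡⟨ sum-permutationsOf 1 rest ascDesWeight (map-suc-upTo-sorted (suc N)) ⟩
    eulerianSum (length rest) ascDesWeight
      ≡⟨ cong (λ m → eulerianSum m ascDesWeight) length-rest ⟩
    eulerianSum N ascDesWeight ∎
    where
    pairWeight : List ℕ × List Bool → ℚ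
    pairWeight (σ , bs) = barWeight σ bs
    rest : List ℕ
    rest = map suc (applyUpTo suc N)
    length-rest : length rest ≡ N
    length-rest = trans (ListP.length-map suc (applyUpTo suc N)) (ListP.length-applyUpTo suc N)
    sum-bars-of-length : ∀ {σ} → length σ ≡ suc N → sumℚ (map (barWeight σ) (boolLists N)) ≡ weight ascDesWeight σ
    sum-bars-of-length {x ∷ w} len rewrite sym (ℕP.suc-injective len) = sum-bars x w

binomialWeight : ℕ → Table
binomialWeight i d a = ι (choose a i)

eulerianSum-binomialWeight-< : ∀ n i → n < i → eulerianSum n (binomialWeight i) ≡ 0ℚ
eulerianSum-binomialWeight-< n i n<i = trans
  (eulerianSum-cong n (λ d a d+a≡n → cong ι (choose-< a i (ℕP.≤-<-trans (subst (a ≤_) d+a≡n (ℕP.m≤n+m a d)) n<i))))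
  (eulerianSum-zero n)

insertMin-binomialWeight-zero : ∀ d a → insertMin (binomialWeight 0) d a ≡ ι (suc (suc (d ℕ.+ a))) * binomialWeight 0 d a
insertMin-binomialWeight-zero d a = trans
  (solve 2 (λ x y → (con 1ℚ :+ x) :* (con 1ℚ :+ con 0ℚ) :+ (con 1ℚ :+ y) :* (con 1ℚ :+ con 0ℚ)
                    := (con 1ℚ :+ (con 1ℚ :+ (x :+ y))) :* (con 1ℚ :+ con 0ℚ)) refl (ι d) (ι a))
  (cong (λ x → (1ℚ + (1ℚ + x)) * ι 1) (sym (ι-homo-+ d a)))

insertMin-binomialWeight-suc : ∀ i k d a → d ℕ.+ a ≡ i ℕ.+ k →
  insertMin (binomialWeight (suc i)) d a ≡ ι (suc k) * (binomialWeight (suc i) d a + binomialWeight i d a)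
insertMin-binomialWeight-suc i k d a d+a≡i+k = begin
  ι (suc d) * ι (choose (suc a) (suc i)) + ι (suc a) * ι (choose a (suc i))
    ≡⟨ sym (cong₂ _+_ (ι-homo-* (suc d) (choose (suc a) (suc i))) (ι-homo-* (suc a) (choose a (suc i)))) ⟩
  ι (suc d ℕ.* choose (suc a) (suc i)) + ι (suc a ℕ.* choose a (suc i))
    ≡⟨ sym (ι-homo-+ (suc d ℕ.* choose (suc a) (suc i)) (suc a ℕ.* choose a (suc i))) ⟩
  ι (suc d ℕ.* choose (suc a) (suc i) ℕ.+ suc a ℕ.* choose a (suc i))
    ≡⟨ cong ι (insertMin-choose i k d a d+a≡i+k) ⟩
  ι (suc k ℕ.* (choose a (suc i) ℕ.+ choose a i))
    ≡⟨ trans (ι-homo-* (suc k) (choose a (suc i) ℕ.+ choose a i)) (cong (ι (suc k) *_) (ι-homo-+ (choose a (suc i)) (choose a i))) ⟩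
  ι (suc k) * (ι (choose a (suc i)) + ι (choose a i)) ∎

eulerianSum-binomialWeight : ∀ i k → eulerianSum (i ℕ.+ k) (binomialWeight i) ≡ ι (surjections (suc (i ℕ.+ k)) (suc k))
eulerianSum-binomialWeight zero    zero    = refl
eulerianSum-binomialWeight zero    (suc k) = begin
  eulerianSum k (insertMin (binomialWeight 0))
    ≡⟨ eulerianSum-cong k (λ d a d+a≡k → trans (insertMin-binomialWeight-zero d a)
                                             (cong (λ m → ι (suc (suc m)) * ι 1) d+a≡k)) ⟩
  eulerianSum k (λ d a → ι (suc (suc k)) * binomialWeight 0 d a)
    ≡⟨ sym (*-distribˡ-eulerianSum k (ι (suc (suc k))) (binomialWeight 0)) ⟩
  ι (suc (suc k)) * eulerianSum k (binomialWeight 0)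
    ≡⟨ cong (ι (suc (suc k)) *_) (eulerianSum-binomialWeight zero k) ⟩
  ι (suc (suc k)) * ι (surjections (suc k) (suc k))
    ≡⟨ sym (ι-homo-* (suc (suc k)) (surjections (suc k) (suc k))) ⟩
  ι (suc (suc k) ℕ.* surjections (suc k) (suc k))
    ≡⟨ cong (λ m → ι (suc (suc k) ℕ.* (m ℕ.+ surjections (suc k) (suc k))))
            (sym (surjections-< (suc k) (suc (suc k)) (ℕP.n<1+n (suc k)))) ⟩
  ι (surjections (suc (suc k)) (suc (suc k))) ∎
eulerianSum-binomialWeight (suc i) k = begin
  eulerianSum (i ℕ.+ k) (insertMin (binomialWeight (suc i)))
    ≡⟨ eulerianSum-cong (i ℕ.+ k) (insertMin-binomialWeight-suc i k) ⟩
  eulerianSum (i ℕ.+ k) (λ d a → ι (suc k) * (binomialWeight (suc i) d a + binomialWeight i d a))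
    ≡⟨ sym (*-distribˡ-eulerianSum (i ℕ.+ k) (ι (suc k)) (λ d a → binomialWeight (suc i) d a + binomialWeight i d a)) ⟩
  ι (suc k) * eulerianSum (i ℕ.+ k) (λ d a → binomialWeight (suc i) d a + binomialWeight i d a)
    ≡⟨ cong (ι (suc k) *_) (eulerianSum-distrib-+ (i ℕ.+ k) (binomialWeight (suc i)) (binomialWeight i)) ⟩
  ι (suc k) * (eulerianSum (i ℕ.+ k) (binomialWeight (suc i)) + eulerianSum (i ℕ.+ k) (binomialWeight i))
    ≡⟨ cong (ι (suc k) *_) (cong₂ _+_ (shifted k) (eulerianSum-binomialWeight i k)) ⟩
  ι (suc k) * (ι (surjections (suc (i ℕ.+ k)) k) + ι (surjections (suc (i ℕ.+ k)) (suc k)))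
    ≡⟨ cong (ι (suc k) *_) (ℚP.+-comm (ι (surjections (suc (i ℕ.+ k)) k)) (ι (surjections (suc (i ℕ.+ k)) (suc k)))) ⟩
  ι (suc k) * (ι (surjections (suc (i ℕ.+ k)) (suc k)) + ι (surjections (suc (i ℕ.+ k)) k))
    ≡⟨ sym (ι-surjections (suc (i ℕ.+ k)) k) ⟩
  ι (surjections (suc (suc (i ℕ.+ k))) (suc k)) ∎
  where
  shifted : ∀ k → eulerianSum (i ℕ.+ k) (binomialWeight (suc i)) ≡ ι (surjections (suc (i ℕ.+ k)) k)
  shifted zero    = eulerianSum-binomialWeight-< (i ℕ.+ 0) (suc i) (s≤s (ℕP.≤-reflexive (ℕP.+-identityʳ i)))
  shifted (suc k) = begin
    eulerianSum (i ℕ.+ suc k) (binomialWeight (suc i))  ≡⟨ cong (λ m → eulerianSum m (binomialWeight (suc i))) (ℕP.+-suc i k) ⟩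
    eulerianSum (suc i ℕ.+ k) (binomialWeight (suc i))  ≡⟨ eulerianSum-binomialWeight (suc i) k ⟩
    ι (surjections (suc (suc (i ℕ.+ k))) (suc k))       ≡⟨ cong (λ m → ι (surjections (suc m) (suc k))) (sym (ℕP.+-suc i k)) ⟩
    ι (surjections (suc (i ℕ.+ suc k)) (suc k))         ∎

-- Fubini polynomials

module Fubini (z : ℚ) where

  shift-antidiagonal : ∀ n (c : ℕ → ℚ) → c (suc n) ≡ 0ℚ →
    z * ∑[ i + k ≡ n ] (c i * z ^ k) ≡ ∑[ i + k ≡ suc n ] (c i * z ^ k)
  shift-antidiagonal n c c[1+n]≡0 = begin
    z * ∑[ i + k ≡ n ] (c i * z ^ k)            ≡⟨ *-distribˡ-antidiagonalSum n z (λ i k → c i * z ^ k) ⟩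
    ∑[ i + k ≡ n ] (z * (c i * z ^ k))          ≡⟨ antidiagonalSum-cong n (λ i k _ →
                                                     solve 3 (λ z c w → z :* (c :* w) := c :* (z :* w)) refl z (c i) (z ^ k)) ⟩
    ∑[ i + k ≡ n ] (c i * z ^ suc k)            ≡⟨ sym (ℚP.+-identityˡ (∑[ i + k ≡ n ] (c i * z ^ suc k))) ⟩
    0ℚ + ∑[ i + k ≡ n ] (c i * z ^ suc k)       ≡⟨ cong (_+ ∑[ i + k ≡ n ] (c i * z ^ suc k))
                                                     (sym (trans (cong (_* 1ℚ) c[1+n]≡0) (ℚP.*-zeroˡ 1ℚ))) ⟩
    c (suc n) * 1ℚ + ∑[ i + k ≡ n ] (c i * z ^ suc k)  ≡⟨ sym (antidiagonalSum-peelʳ n (λ i k → c i * z ^ k)) ⟩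
    ∑[ i + k ≡ suc n ] (c i * z ^ k)            ∎

  binomial : ∀ a → (1ℚ + z) ^ a ≡ ∑[ i + k ≡ a ] (ι (choose a i) * z ^ k)
  binomial zero    = refl
  binomial (suc a) = begin
    (1ℚ + z) * (1ℚ + z) ^ a       ≡⟨ cong ((1ℚ + z) *_) (binomial a) ⟩
    (1ℚ + z) * B                  ≡⟨ solve 2 (λ z B → (con 1ℚ :+ z) :* B := B :+ z :* B) refl z B ⟩
    B + z * B                     ≡⟨ cong (B +_) (shift-antidiagonal a (ι ∘ choose a) (cong ι (choose-< a (suc a) (ℕP.n<1+n a)))) ⟩
    B + ∑[ i + k ≡ suc a ] (ι (choose a i) * z ^ k)
      ≡⟨ solve 3 (λ B x B′ → B :+ (x :+ B′) := x :+ (B :+ B′)) refl B (ι 1 * z ^ suc a) B′ ⟩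
    ι 1 * z ^ suc a + (B + B′)    ≡⟨ cong (ι 1 * z ^ suc a +_) (sym pascal) ⟩
    ∑[ i + k ≡ suc a ] (ι (choose (suc a) i) * z ^ k) ∎
    where
    B  = ∑[ i + k ≡ a ] (ι (choose a i) * z ^ k)
    B′ = ∑[ i + k ≡ a ] (ι (choose a (suc i)) * z ^ k)
    pascal : ∑[ i + k ≡ a ] (ι (choose (suc a) (suc i)) * z ^ k) ≡ B + B′
    pascal = trans
      (antidiagonalSum-cong a (λ i k _ → trans (cong (_* z ^ k) (ι-homo-+ (choose a i) (choose a (suc i))))
                                                (ℚP.*-distribʳ-+ (z ^ k) (ι (choose a i)) (ι (choose a (suc i))))))
      (antidiagonalSum-distrib-+ a (λ i k → ι (choose a i) * z ^ k) (λ i k → ι (choose a (suc i)) * z ^ k))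

  -- The coefficient of z^k is C(a, k − d); indexing it by i = d + a − k along the antidiagonal
  -- keeps truncated subtraction out.
  power*binomial : ∀ d a → z ^ d * (1ℚ + z) ^ a ≡ ∑[ i + k ≡ d ℕ.+ a ] (ι (choose a i) * z ^ k)
  power*binomial zero    a = trans (ℚP.*-identityˡ ((1ℚ + z) ^ a)) (binomial a)
  power*binomial (suc d) a = begin
    z * z ^ d * (1ℚ + z) ^ a                              ≡⟨ ℚP.*-assoc z (z ^ d) ((1ℚ + z) ^ a) ⟩
    z * (z ^ d * (1ℚ + z) ^ a)                            ≡⟨ cong (z *_) (power*binomial d a) ⟩
    z * ∑[ i + k ≡ d ℕ.+ a ] (ι (choose a i) * z ^ k)     ≡⟨ shift-antidiagonal (d ℕ.+ a) (ι ∘ choose a)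
                                                               (cong ι (choose-< a (suc (d ℕ.+ a)) (s≤s (ℕP.m≤n+m a d)))) ⟩
    ∑[ i + k ≡ suc d ℕ.+ a ] (ι (choose a i) * z ^ k)     ∎

  fubini : ℕ → ℚ
  fubini n = ∑[ k < n ] (ι (surjections n (suc k)) * z ^ k)

  fubini-recurrence : ∀ n → fubini (suc n) ≡ 1ℚ + z * ∑[ m < suc n ] (ι (choose (suc n) m) * fubini m)
  fubini-recurrence n = cong₂ _+_ (cong (λ m → ι m * 1ℚ) (surjections-onto-1 n)) (begin
    ∑[ k < n ] (ι (surjections (suc n) (suc (suc k))) * z ^ suc k)
      ≡⟨ rangeSum-cong n (λ k _ → term k) ⟩
    ∑[ k < n ] (z * ∑[ m < suc n ] (ι (choose (suc n) m) * (ι (surjections m (suc k)) * z ^ k)))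
      ≡⟨ sym (*-distribˡ-rangeSum n z (λ k → ∑[ m < suc n ] (ι (choose (suc n) m) * (ι (surjections m (suc k)) * z ^ k)))) ⟩
    z * ∑[ k < n ] ∑[ m < suc n ] (ι (choose (suc n) m) * (ι (surjections m (suc k)) * z ^ k))
      ≡⟨ cong (z *_) (rangeSum-comm n (suc n) (λ k m → ι (choose (suc n) m) * (ι (surjections m (suc k)) * z ^ k))) ⟩
    z * ∑[ m < suc n ] ∑[ k < n ] (ι (choose (suc n) m) * (ι (surjections m (suc k)) * z ^ k))
      ≡⟨ cong (z *_) (rangeSum-cong (suc n) (λ m m<1+n → trans
           (sym (*-distribˡ-rangeSum n (ι (choose (suc n) m)) (λ k → ι (surjections m (suc k)) * z ^ k)))
           (cong (ι (choose (suc n) m) *_) (truncate m (ℕP.≤-pred m<1+n))))) ⟩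
    z * ∑[ m < suc n ] (ι (choose (suc n) m) * fubini m) ∎)
    where
    term : ∀ k → ι (surjections (suc n) (suc (suc k))) * z ^ suc k
               ≡ z * ∑[ m < suc n ] (ι (choose (suc n) m) * (ι (surjections m (suc k)) * z ^ k))
    term k = begin
      ι (surjections (suc n) (suc (suc k))) * (z * z ^ k)
        ≡⟨ cong (_* (z * z ^ k)) (surjections-convolution (suc n) (suc k)) ⟩
      S * (z * z ^ k)
        ≡⟨ solve 3 (λ S z w → S :* (z :* w) := z :* (w :* S)) refl S z (z ^ k) ⟩
      z * (z ^ k * S)
        ≡⟨ cong (z *_) (trans (*-distribˡ-rangeSum (suc n) (z ^ k) (λ m → ι (choose (suc n) m) * ι (surjections m (suc k))))
             (rangeSum-cong (suc n) (λ m _ → solve 3 (λ w c s → w :* (c :* s) := c :* (s :* w)) refl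
                                                (z ^ k) (ι (choose (suc n) m)) (ι (surjections m (suc k)))))) ⟩
      z * ∑[ m < suc n ] (ι (choose (suc n) m) * (ι (surjections m (suc k)) * z ^ k)) ∎
      where S = ∑[ m < suc n ] (ι (choose (suc n) m) * ι (surjections m (suc k)))
    truncate : ∀ m → m ≤ n → ∑[ k < n ] (ι (surjections m (suc k)) * z ^ k) ≡ fubini m
    truncate m m≤n = rangeSum-vanishing (λ k → ι (surjections m (suc k)) * z ^ k) m≤n
      (λ k m≤k → trans (cong (λ s → ι s * z ^ k) (surjections-< m (suc k) (s≤s m≤k))) (ℚP.*-zeroˡ (z ^ k)))

module _ (t q ρ : ℚ) (ρ[1-t]≡1 : ρ * (1ℚ - t) ≡ 1ℚ) where

  open Fubini ((q + t) * ρ)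

  private
    z : ℚ
    z = (q + t) * ρ

  ρ[q+1]≡1+z : ρ * (q + 1ℚ) ≡ 1ℚ + z
  ρ[q+1]≡1+z = begin
    ρ * (q + 1ℚ)                     ≡⟨ cong (ρ *_) (solve 2 (λ q t → q :+ con 1ℚ := (con 1ℚ :- t) :+ (q :+ t)) refl q t) ⟩
    ρ * ((1ℚ - t) + (q + t))         ≡⟨ ℚP.*-distribˡ-+ ρ (1ℚ - t) (q + t) ⟩
    ρ * (1ℚ - t) + ρ * (q + t)       ≡⟨ cong₂ _+_ ρ[1-t]≡1 (ℚP.*-comm ρ (q + t)) ⟩
    1ℚ + z                           ∎

  ρ^*ascDesWeight : ∀ d a → ρ ^ (d ℕ.+ a) * ascDesWeight t q d a ≡ z ^ d * (1ℚ + z) ^ a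
  ρ^*ascDesWeight d a = begin
    ρ ^ (d ℕ.+ a) * ((q + t) ^ d * (q + 1ℚ) ^ a)          ≡⟨ cong (_* ((q + t) ^ d * (q + 1ℚ) ^ a)) (^-distribˡ-+-* ρ d a) ⟩
    ρ ^ d * ρ ^ a * ((q + t) ^ d * (q + 1ℚ) ^ a)          ≡⟨ solve 4 (λ x y u v → x :* y :* (u :* v) := (u :* x) :* (y :* v)) refl
                                                                (ρ ^ d) (ρ ^ a) ((q + t) ^ d) ((q + 1ℚ) ^ a) ⟩
    (q + t) ^ d * ρ ^ d * (ρ ^ a * (q + 1ℚ) ^ a)          ≡⟨ cong₂ _*_ (sym (^-distribʳ-* (q + t) ρ d))
                                                                         (sym (^-distribʳ-* ρ (q + 1ℚ) a)) ⟩
    z ^ d * (ρ * (q + 1ℚ)) ^ a                            ≡⟨ cong (λ w → z ^ d * w ^ a) ρ[q+1]≡1+z ⟩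
    z ^ d * (1ℚ + z) ^ a                                  ∎

  α*ρ^≡fubini : ∀ N → α (suc N) t q * ρ ^ N ≡ fubini (suc N)
  α*ρ^≡fubini N = begin
    α (suc N) t q * ρ ^ N
      ≡⟨ trans (cong (_* ρ ^ N) (α-eulerian t q N)) (ℚP.*-comm (eulerianSum N (ascDesWeight t q)) (ρ ^ N)) ⟩
    ρ ^ N * eulerianSum N (ascDesWeight t q)
      ≡⟨ *-distribˡ-eulerianSum N (ρ ^ N) (ascDesWeight t q) ⟩
    eulerianSum N (λ d a → ρ ^ N * ascDesWeight t q d a)
      ≡⟨ eulerianSum-cong N (λ d a d+a≡N → subst (λ m → ρ ^ m * ascDesWeight t q d a ≡ ∑[ i + k ≡ m ] (ι (choose a i) * z ^ k))
                                                   d+a≡N (trans (ρ^*ascDesWeight d a) (power*binomial d a))) ⟩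
    eulerianSum N (λ d a → ∑[ i + k ≡ N ] (ι (choose a i) * z ^ k))
      ≡⟨ eulerianSum-antidiagonalSum N N (λ d a i k → ι (choose a i) * z ^ k) ⟩
    ∑[ i + k ≡ N ] eulerianSum N (λ d a → binomialWeight i d a * z ^ k)
      ≡⟨ antidiagonalSum-cong N (λ i k i+k≡N → trans (*-distribʳ-eulerianSum N (z ^ k) (binomialWeight i))
           (subst (λ m → eulerianSum m (binomialWeight i) * z ^ k ≡ ι (surjections (suc m) (suc k)) * z ^ k)
                  i+k≡N (cong (_* z ^ k) (eulerianSum-binomialWeight i k)))) ⟩
    ∑[ i + k ≡ N ] (ι (surjections (suc N) (suc k)) * z ^ k)
      ≡⟨ antidiagonalSum-snd N (λ k → ι (surjections (suc N) (suc k)) * z ^ k) ⟩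
    fubini (suc N) ∎

-- Power series

expDenom : ℕ → ℕ
expDenom k = 2 ℕ.^ k ℕ.* k !

expDenom≢0 : ∀ k → ℕ.NonZero (expDenom k)
expDenom≢0 k = ℕP.m*n≢0 (2 ℕ.^ k) (k !) {{ℕP.m^n≢0 2 k}} {{k ℕP.!≢0}}

expCoeff : ℕ → ℚ
expCoeff k = recipℕ (expDenom k)

expCoeff-* : ∀ a b → expCoeff a * expCoeff b ≡ ι (choose (a ℕ.+ b) b) * expCoeff (a ℕ.+ b)
expCoeff-* a b = trans (sym (recipℕ-homo-* (expDenom a) (expDenom b) {{expDenom≢0 a}} {{expDenom≢0 b}}))
  (sym (recipℕ-unique (expDenom a ℕ.* expDenom b) {{ℕP.m*n≢0 (expDenom a) (expDenom b) {{expDenom≢0 a}} {{expDenom≢0 b}}}} (begin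
    ι (expDenom a ℕ.* expDenom b) * (ι C * expCoeff (a ℕ.+ b))   ≡⟨ sym (ℚP.*-assoc (ι (expDenom a ℕ.* expDenom b)) (ι C) _) ⟩
    ι (expDenom a ℕ.* expDenom b) * ι C * expCoeff (a ℕ.+ b)     ≡⟨ cong (_* expCoeff (a ℕ.+ b))
                                                                          (sym (ι-homo-* (expDenom a ℕ.* expDenom b) C)) ⟩
    ι (expDenom a ℕ.* expDenom b ℕ.* C) * expCoeff (a ℕ.+ b)     ≡⟨ cong (λ m → ι m * expCoeff (a ℕ.+ b)) denominators ⟩
    ι (expDenom (a ℕ.+ b)) * expCoeff (a ℕ.+ b)                  ≡⟨ ι*recipℕ (expDenom (a ℕ.+ b)) {{expDenom≢0 (a ℕ.+ b)}} ⟩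
    1ℚ                                                           ∎)))
  where
  C = choose (a ℕ.+ b) b
  regroup : ∀ p q x y c → p ℕ.* x ℕ.* (q ℕ.* y) ℕ.* c ≡ p ℕ.* q ℕ.* (c ℕ.* (x ℕ.* y))
  regroup = solve-∀
  denominators : expDenom a ℕ.* expDenom b ℕ.* C ≡ expDenom (a ℕ.+ b)
  denominators = trans (regroup (2 ℕ.^ a) (2 ℕ.^ b) (a !) (b !) C)
    (cong₂ ℕ._*_ (sym (ℕP.^-distribˡ-+-* 2 a b)) (choose-factorials a b))

recipℕ-2^m*[1+m]! : ∀ m → recipℕ (2 ℕ.^ m ℕ.* suc m !) ≡ ι 2 * expCoeff (suc m)
recipℕ-2^m*[1+m]! m = sym (recipℕ-unique (2 ℕ.^ m ℕ.* suc m !)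
                                         {{ℕP.m*n≢0 (2 ℕ.^ m) (suc m !) {{ℕP.m^n≢0 2 m}} {{suc m ℕP.!≢0}}}} (begin
  ι (2 ℕ.^ m ℕ.* suc m !) * (ι 2 * expCoeff (suc m))  ≡⟨ sym (ℚP.*-assoc (ι (2 ℕ.^ m ℕ.* suc m !)) (ι 2) (expCoeff (suc m))) ⟩
  ι (2 ℕ.^ m ℕ.* suc m !) * ι 2 * expCoeff (suc m)    ≡⟨ cong (_* expCoeff (suc m)) (sym (ι-homo-* (2 ℕ.^ m ℕ.* suc m !) 2)) ⟩
  ι (2 ℕ.^ m ℕ.* suc m ! ℕ.* 2) * expCoeff (suc m)    ≡⟨ cong (λ k → ι k * expCoeff (suc m)) (double (2 ℕ.^ m) (suc m !)) ⟩
  ι (expDenom (suc m)) * expCoeff (suc m)             ≡⟨ ι*recipℕ (expDenom (suc m)) {{expDenom≢0 (suc m)}} ⟩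
  1ℚ                                                  ∎))
  where
  double : ∀ p f → p ℕ.* f ℕ.* 2 ≡ 2 ℕ.* p ℕ.* f
  double = solve-∀

_⋆_ : Series → Series → Series
(g ⋆ h) n = ∑[ a + b ≡ n ] (g a * h b)

⋆-constˡ : ∀ c h n → (constS c ⋆ h) n ≡ c * h n
⋆-constˡ c h zero    = refl
⋆-constˡ c h (suc n) = trans (cong (c * h (suc n) +_) (antidiagonalSum-zero n _ (λ _ b → ℚP.*-zeroˡ (h b))))
  (ℚP.+-identityʳ (c * h (suc n)))

⋆-constʳ : ∀ g c n → (g ⋆ constS c) n ≡ g n * c
⋆-constʳ g c zero    = refl
⋆-constʳ g c (suc n) = trans (antidiagonalSum-peelʳ n (λ a b → g a * constS c b))
  (trans (cong (g (suc n) * c +_) (antidiagonalSum-zero n _ (λ a _ → ℚP.*-zeroʳ (g a)))) (ℚP.+-identityʳ (g (suc n) * c)))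

⋆-affineˡ : ∀ a s u h n → ((constS a ⊖ (s · u)) ⋆ h) n ≡ a * h n - s * (u ⋆ h) n
⋆-affineˡ a s u h n = begin
  ∑[ i + j ≡ n ] ((constS a i - s * u i) * h j)
    ≡⟨ antidiagonalSum-cong n (λ i j _ → solve 4 (λ k s u y → (k :- s :* u) :* y := k :* y :+ (:- s) :* (u :* y))
                                              refl (constS a i) s (u i) (h j)) ⟩
  ∑[ i + j ≡ n ] (constS a i * h j + - s * (u i * h j))
    ≡⟨ antidiagonalSum-distrib-+ n (λ i j → constS a i * h j) (λ i j → - s * (u i * h j)) ⟩
  (constS a ⋆ h) n + ∑[ i + j ≡ n ] (- s * (u i * h j))
    ≡⟨ cong₂ _+_ (⋆-constˡ a h n) (sym (*-distribˡ-antidiagonalSum n (- s) (λ i j → u i * h j))) ⟩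
  a * h n + - s * (u ⋆ h) n
    ≡⟨ solve 3 (λ x s w → x :+ (:- s) :* w := x :- s :* w) refl (a * h n) s ((u ⋆ h) n) ⟩
  a * h n - s * (u ⋆ h) n ∎

⋆-affineʳ : ∀ g h k x → (∀ j → h j ≡ constS 1ℚ j + x * k j) → ∀ n → (g ⋆ h) n ≡ g n + x * (g ⋆ k) n
⋆-affineʳ g h k x h≡1+xk n = begin
  ∑[ i + j ≡ n ] (g i * h j)
    ≡⟨ antidiagonalSum-cong n (λ i j _ → trans (cong (g i *_) (h≡1+xk j))
         (solve 4 (λ a o x y → a :* (o :+ x :* y) := a :* o :+ x :* (a :* y)) refl (g i) (constS 1ℚ j) x (k j))) ⟩
  ∑[ i + j ≡ n ] (g i * constS 1ℚ j + x * (g i * k j))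
    ≡⟨ antidiagonalSum-distrib-+ n (λ i j → g i * constS 1ℚ j) (λ i j → x * (g i * k j)) ⟩
  (g ⋆ constS 1ℚ) n + ∑[ i + j ≡ n ] (x * (g i * k j))
    ≡⟨ cong₂ _+_ (trans (⋆-constʳ g 1ℚ n) (ℚP.*-identityʳ (g n))) (sym (*-distribˡ-antidiagonalSum n x (λ i j → g i * k j))) ⟩
  g n + x * (g ⋆ k) n ∎

history : Series → (n : ℕ) → Vec ℚ (suc n)
history h zero    = h 0 ∷ []
history h (suc n) = h (suc n) ∷ history h n

head-history : ∀ h n → head (history h n) ≡ h n
head-history h zero    = refl
head-history h (suc n) = refl

shiftedDot : Series → ∀ {m} → ℕ → Vec ℚ m → ℚ
shiftedDot g j []       = 0ℚ
shiftedDot g j (x ∷ xs) = g (suc j) * x + shiftedDot g (suc j) xs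

shiftedDot-history : ∀ g h j n → shiftedDot g j (history h n) ≡ ∑[ a + b ≡ n ] (g (suc (j ℕ.+ a)) * h b)
shiftedDot-history g h j zero    = trans (ℚP.+-identityʳ _) (cong (λ m → g (suc m) * h 0) (sym (ℕP.+-identityʳ j)))
shiftedDot-history g h j (suc n) = cong₂ _+_
  (cong (λ m → g (suc m) * h (suc n)) (sym (ℕP.+-identityʳ j)))
  (trans (shiftedDot-history g h (suc j) n) (antidiagonalSum-cong n (λ a b _ → cong (λ m → g (suc m) * h b) (sym (ℕP.+-suc j a)))))

Convolution : Set
Convolution = (m : ℕ) → ℕ → Vec ℚ m → ℚ

shiftedDot-unique : ∀ g (c : Convolution) → (∀ j → c 0 j [] ≡ 0ℚ) →
  (∀ {m} j x (xs : Vec ℚ m) → c (suc m) j (x ∷ xs) ≡ g (suc j) * x + c m (suc j) xs) →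
  ∀ {m} j (v : Vec ℚ m) → c m j v ≡ shiftedDot g j v
shiftedDot-unique g c c[] c∷ j []       = c[] j
shiftedDot-unique g c c[] c∷ j (x ∷ xs) = trans (c∷ j x xs) (cong (g (suc j) * x +_) (shiftedDot-unique g c c[] c∷ (suc j) xs))

-- divVec is computed with a convolution that Defs keeps private.  The metavariable c (exported
-- as c′) is solved to it by unification, which needs the unfolded goal to apply it to variables
-- only: hence the with-abstractions, including that of the literal 2 (0 and 1 occur in the type of p).
hiddenConvolution : ∀ f g (p : g 0 ≢ 0ℚ) →
  let c : Convolution
      c = _
  in (n : ℕ) → Σ[ c′ ∈ Convolution ] c′ ≡ c ×
     head (divVec f g p (suc (suc n))) ≡ (f (suc (suc n)) - (g 1 * head (divVec f g p (suc n))
       + (g 2 * head (divVec f g p n) + c n 2 (tail (divVec f g p n))))) * (1/ g 0) ⦃ ≢-nonZero p ⦄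
hiddenConvolution f g p n with head (divVec f g p (suc n))
... | x with divVec f g p n
... | y ∷ ys with (1/ g 0) ⦃ ≢-nonZero p ⦄
... | g₀⁻¹ with 2
... | j = _ , refl , refl

divVec-suc : ∀ f g (p : g 0 ≢ 0ℚ) n →
  head (divVec f g p (suc n)) ≡ (f (suc n) - shiftedDot g 0 (divVec f g p n)) * (1/ g 0) ⦃ ≢-nonZero p ⦄
divVec-suc f g p n = cong (λ s → (f (suc n) - s) * (1/ g 0) ⦃ ≢-nonZero p ⦄)
  (shiftedDot-unique g (proj₁ (hiddenConvolution f g p 0)) (λ _ → refl) (λ _ _ _ → refl) 0 (divVec f g p n))

*-1/-cancel : ∀ a x .{{_ : ℚ.NonZero a}} → a * x * 1/ a ≡ x
*-1/-cancel a x = begin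
  a * x * 1/ a    ≡⟨ solve 3 (λ a x i → a :* x :* i := (a :* i) :* x) refl a x (1/ a) ⟩
  a * 1/ a * x    ≡⟨ cong (_* x) (ℚP.*-inverseʳ a) ⟩
  1ℚ * x          ≡⟨ ℚP.*-identityˡ x ⟩
  x               ∎

divVec-history : ∀ f g h (p : g 0 ≢ 0ℚ) → (∀ n → (g ⋆ h) n ≡ f n) → ∀ n → divVec f g p n ≡ history h n
divVec-history f g h p g⋆h≡f zero    =
  cong (_∷ []) (trans (cong (_* (1/ g 0) ⦃ ≢-nonZero p ⦄) (sym (g⋆h≡f 0))) (*-1/-cancel (g 0) (h 0) ⦃ ≢-nonZero p ⦄))
divVec-history f g h p g⋆h≡f (suc n) = cong₂ _∷_ (begin
  head (divVec f g p (suc n))                                ≡⟨ divVec-suc f g p n ⟩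
  (f (suc n) - shiftedDot g 0 (divVec f g p n)) * g₀⁻¹       ≡⟨ cong (λ v → (f (suc n) - shiftedDot g 0 v) * g₀⁻¹)
                                                                    (divVec-history f g h p g⋆h≡f n) ⟩
  (f (suc n) - S) * g₀⁻¹                                     ≡⟨ cong (λ y → (y - S) * g₀⁻¹) (sym (g⋆h≡f (suc n))) ⟩
  (g 0 * h (suc n) + ∑[ a + b ≡ n ] (g (suc a) * h b) - S) * g₀⁻¹
    ≡⟨ cong (λ y → (g 0 * h (suc n) + y - S) * g₀⁻¹) (sym (shiftedDot-history g h 0 n)) ⟩
  (g 0 * h (suc n) + S - S) * g₀⁻¹                           ≡⟨ solve 4 (λ a x s i → (a :* x :+ s :- s) :* i := a :* x :* i) refl
                                                                   (g 0) (h (suc n)) S g₀⁻¹ ⟩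
  g 0 * h (suc n) * g₀⁻¹                                     ≡⟨ *-1/-cancel (g 0) (h (suc n)) ⦃ ≢-nonZero p ⦄ ⟩
  h (suc n)                                                  ∎)
  (divVec-history f g h p g⋆h≡f n)
  where
  g₀⁻¹ = (1/ g 0) ⦃ ≢-nonZero p ⦄
  S = shiftedDot g 0 (history h n)

divS-unique : ∀ f g h (p : g 0 ≢ 0ℚ) → (∀ n → (g ⋆ h) n ≡ f n) → ∀ n → divS f g p n ≡ h n
divS-unique f g h p g⋆h≡f n = trans (cong head (divVec-history f g h p g⋆h≡f n)) (head-history h n)

module _ (t q : ℚ) (t≢1 : 1ℚ - t ≢ 0ℚ) where

  private
    r ρ z c : ℚ
    r = 1ℚ - t
    ρ = (1/ r) ⦃ ≢-nonZero t≢1 ⦄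
    z = (q + t) * ρ
    c = ι 2 * t * ρ

    ρr≡1 : ρ * r ≡ 1ℚ
    ρr≡1 = ℚP.*-inverseˡ r ⦃ ≢-nonZero t≢1 ⦄

    U D L : Series
    U = expHalfMinus1
    D = denSeries t q
    L = lhsSeries t q t≢1

  open Fubini z using (fubini; fubini-recurrence)

  fubiniSeries : Series
  fubiniSeries n = fubini n * expCoeff n

  fubiniSeries-equation : ∀ n → fubiniSeries n ≡ U n + z * (U ⋆ fubiniSeries) n
  fubiniSeries-equation zero    =
    solve 2 (λ e z → con 0ℚ :* e := con 0ℚ :+ z :* (con 0ℚ :* (con 0ℚ :* e))) refl (expCoeff 0) z
  fubiniSeries-equation (suc m) = begin
    fubini (suc m) * E                               ≡⟨ cong (_* E) (fubini-recurrence m) ⟩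
    (1ℚ + z * S) * E                                 ≡⟨ solve 4 (λ z S E Y → (con 1ℚ :+ z :* S) :* E := E :+ z :* (con 0ℚ :* Y :+ E :* S))
                                                              refl z S E (fubiniSeries (suc m)) ⟩
    E + z * (0ℚ * fubiniSeries (suc m) + E * S)      ≡⟨ cong (λ w → E + z * (0ℚ * fubiniSeries (suc m) + w)) (sym convolution-tail) ⟩
    U (suc m) + z * (U ⋆ fubiniSeries) (suc m)       ∎
    where
    E = expCoeff (suc m)
    C : ℕ → ℚ
    C b = ι (choose (suc m) b) * fubini b
    S = rangeSum (suc m) C
    term : ∀ a b → a ℕ.+ b ≡ m → expCoeff (suc a) * (fubini b * expCoeff b) ≡ E * (ι (choose (suc m) b) * fubini b)
    term a b a+b≡m = begin
      expCoeff (suc a) * (fubini b * expCoeff b)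
        ≡⟨ solve 3 (λ x f y → x :* (f :* y) := f :* (x :* y)) refl (expCoeff (suc a)) (fubini b) (expCoeff b) ⟩
      fubini b * (expCoeff (suc a) * expCoeff b)
        ≡⟨ cong (fubini b *_) (expCoeff-* (suc a) b) ⟩
      fubini b * (ι (choose (suc a ℕ.+ b) b) * expCoeff (suc a ℕ.+ b))
        ≡⟨ cong (λ k → fubini b * (ι (choose k b) * expCoeff k)) (cong suc a+b≡m) ⟩
      fubini b * (ι (choose (suc m) b) * E)
        ≡⟨ solve 3 (λ f x e → f :* (x :* e) := e :* (x :* f)) refl (fubini b) (ι (choose (suc m) b)) E ⟩
      E * (ι (choose (suc m) b) * fubini b) ∎
    convolution-tail : ∑[ a + b ≡ m ] (U (suc a) * fubiniSeries b) ≡ E * S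
    convolution-tail = begin
      ∑[ a + b ≡ m ] (U (suc a) * fubiniSeries b)            ≡⟨ antidiagonalSum-cong m term ⟩
      ∑[ a + b ≡ m ] (E * (ι (choose (suc m) b) * fubini b)) ≡⟨ sym (*-distribˡ-antidiagonalSum m E (λ _ b → C b)) ⟩
      E * ∑[ a + b ≡ m ] C b                                 ≡⟨ cong (E *_) (antidiagonalSum-snd m C) ⟩
      E * S                                                   ∎

  lhsSeries-fubini : ∀ n → L n ≡ constS 1ℚ n + c * fubiniSeries n
  lhsSeries-fubini zero    = solve 2 (λ c e → con 1ℚ := con 1ℚ :+ c :* (con 0ℚ :* e)) refl c (expCoeff 0)
  lhsSeries-fubini (suc m) = begin
    t * α (suc m) t q * (ρ * ρ ^ m) * recipℕ (2 ℕ.^ m ℕ.* suc m !)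
      ≡⟨ cong (t * α (suc m) t q * (ρ * ρ ^ m) *_) (recipℕ-2^m*[1+m]! m) ⟩
    t * α (suc m) t q * (ρ * ρ ^ m) * (ι 2 * E)
      ≡⟨ solve 6 (λ t A ρ P two E → t :* A :* (ρ :* P) :* (two :* E) := con 0ℚ :+ two :* t :* ρ :* (A :* P :* E))
           refl t (α (suc m) t q) ρ (ρ ^ m) (ι 2) E ⟩
    0ℚ + c * (α (suc m) t q * ρ ^ m * E)
      ≡⟨ cong (λ w → 0ℚ + c * (w * E)) (α*ρ^≡fubini t q ρ ρr≡1 m) ⟩
    0ℚ + c * fubiniSeries (suc m) ∎
    where E = expCoeff (suc m)

  denSeries⋆lhsSeries : ∀ n → (D ⋆ L) n ≡ numSeries t q n
  denSeries⋆lhsSeries n = begin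
    (D ⋆ L) n                                               ≡⟨ ⋆-affineʳ D L fubiniSeries c lhsSeries-fubini n ⟩
    D n + c * (D ⋆ fubiniSeries) n                          ≡⟨ cong (λ x → D n + c * x) (⋆-affineˡ r (q + t) U fubiniSeries n) ⟩
    D n + c * (r * fubiniSeries n - (q + t) * W)            ≡⟨ cong (λ y → D n + c * (r * y - (q + t) * W)) (fubiniSeries-equation n) ⟩
    D n + c * (r * (U n + z * W) - (q + t) * W)
      ≡⟨ solve 7 (λ d c r u z w s → d :+ c :* (r :* (u :+ z :* w) :- s :* w)
                                   := d :+ (c :* r) :* u :+ c :* ((r :* z) :* w :- s :* w))
           refl (D n) c r (U n) z W (q + t) ⟩
    D n + (c * r) * U n + c * ((r * z) * W - (q + t) * W)   ≡⟨ cong₂ (λ x y → D n + x * U n + c * (y * W - (q + t) * W))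
                                                                     c*r≡2t r*z≡q+t ⟩
    D n + (ι 2 * t) * U n + c * ((q + t) * W - (q + t) * W)
      ≡⟨ solve 6 (λ k u w q t c → (k :- (q :+ t) :* u) :+ ((con 1ℚ :+ (con 1ℚ :+ con 0ℚ)) :* t) :* u
                                    :+ c :* ((q :+ t) :* w :- (q :+ t) :* w)
                                  := k :- (q :- t) :* u)
           refl (constS r n) (U n) W q t c ⟩
    numSeries t q n                                         ∎
    where
    W = (U ⋆ fubiniSeries) n
    c*r≡2t : c * r ≡ ι 2 * t
    c*r≡2t = trans (ℚP.*-assoc (ι 2 * t) ρ r) (trans (cong (ι 2 * t *_) ρr≡1) (ℚP.*-identityʳ (ι 2 * t)))
    r*z≡q+t : r * z ≡ q + t
    r*z≡q+t = trans (solve 3 (λ r s ρ → r :* (s :* ρ) := s :* (ρ :* r)) refl r (q + t) ρ)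
      (trans (cong ((q + t) *_) ρr≡1) (ℚP.*-identityʳ (q + t)))

mainTheorem12 : (t q : ℚ) → (t≢1 : 1ℚ - t ≢ 0ℚ) → (n : ℕ) →
    lhsSeries t q t≢1 n ≡ rhsSeries t q t≢1 n
mainTheorem12 t q t≢1 n =
  sym (divS-unique (numSeries t q) (denSeries t q) (lhsSeries t q t≢1) (den₀≢0 t q t≢1) (denSeries⋆lhsSeries t q t≢1) n)
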